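{- We have {\rm (i)} $\mathcal{D}_{12\mbox{ - }3;0}(x)=\dfrac{1+x+x^4-x^5}{1-x^2}$; {\rm (ii)} $\mathcal{D}_{12\mbox{ - }3;1}(x)=\dfrac{x^5(2+3x-4x^2-x^3+2x^4)}{(1-x^2)^2}$; {\rm (iii)} $\mathcal{D}_{12\mbox{ - }3;2}(x)=\dfrac{x^7(2+2x-6x^2-x^3+6x^4+x^5-2x^6)}{(1-x^2)^3}$; {\rm (iv)} $\mathcal{D}_{12\mbox{ - }3;3}(x)=\dfrac{x^7(3+5x-10x^2-9x^3+10x^4+3x^5+4x^7-5x^8-x^9+2x^{10})}{(1-x^2)^4}$; {\rm (v)} $\mathcal{D}_{12\mbox{ - }3;4}(x)=\dfrac{x^9(5+5x-23x^2-7x^3+40x^4-x^5-30x^6+5x^7+5x^8-x^9+5x^{10}+x^{11}-2x^{12})}{(1-x^2)^5}$.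
   Context: A permutation $\pi$ is a Dumont permutation (of the first kind) if each even integer in $\pi$ is followed by a smaller integer, and each odd integer is either followed by a larger integer or is the last element of $\pi$. In the generalized pattern $12\mbox{ - }3$, the letters corresponding to $1$ and $2$ must be adjacent in the permutation, while $3$ may occur anywhere after them. Let $\mathcal{D}_{\tau;r}(n)$ be the number of Dumont permutations of length $n$ that avoid $1\mbox{ - }3\mbox{ - }2$ (the classical pattern $132$) and contain $\tau$ exactly $r$ times, and $\mathcal{D}_{\tau;r}(x)=\sum_{n\geq0}\mathcal{D}_{\tau;r}(n)x^n$. -}

module Defs where

open import Data.Nat as ℕ using (ℕ; zero; suc; _<ᵇ_; _≡ᵇ_; _∸_; _+_)
open import Data.Nat.DivMod using (_%_)
open import Data.Bool using (Bool; true; false; _∧_; _∨_; not; if_then_else_)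
open import Data.List using (List; []; _∷_; length; map; concatMap; upTo; filterᵇ)
open import Data.Bool.ListAction using (all; any)
open import Data.Integer as ℤ using (ℤ; +_; _-_)

_≤ᵇ'_ : ℕ → ℕ → Bool
a ≤ᵇ' b = a <ᵇ suc b

words : ℕ → List ℕ → List (List ℕ)
words zero    A = [] ∷ []
words (suc n) A = concatMap (λ a → map (a ∷_) (words n A)) A

distinct : List ℕ → Bool
distinct []       = true
distinct (a ∷ w)  = all (λ b → not (a ≡ᵇ b)) w ∧ distinct w

isPerm : ℕ → List ℕ → Bool
isPerm n w = (length w ≡ᵇ n) ∧ all (λ a → (1 ≤ᵇ' a) ∧ (a ≤ᵇ' n)) w ∧ distinct w

isEven : ℕ → Bool
isEven a = a % 2 ≡ᵇ 0

dumont : List ℕ → Bool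
dumont []            = true
dumont (a ∷ [])      = not (isEven a)
dumont (a ∷ b ∷ w)   = (if isEven a then b <ᵇ a else a <ᵇ b) ∧ dumont (b ∷ w)

has21Above : ℕ → List ℕ → Bool
has21Above a []      = false
has21Above a (b ∷ w) = any (λ c → (a <ᵇ c) ∧ (c <ᵇ b)) w ∨ has21Above a w

contains132 : List ℕ → Bool
contains132 []      = false
contains132 (a ∷ w) = has21Above a w ∨ contains132 w

countᵇ : (ℕ → Bool) → List ℕ → ℕ
countᵇ p []      = 0
countᵇ p (a ∷ w) = (if p a then 1 else 0) + countᵇ p w

-- number of occurrences of the generalized pattern 12-3:
-- triples (i, i+1, j) with j > i+1 and π_i < π_{i+1} < π_j
occ12-3 : List ℕ → ℕ
occ12-3 []          = 0
occ12-3 (a ∷ [])    = 0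
occ12-3 (a ∷ b ∷ w) = (if a <ᵇ b then countᵇ (λ c → b <ᵇ c) w else 0) + occ12-3 (b ∷ w)

D : ℕ → ℕ → ℕ
D r n = length (filterᵇ (λ w → isPerm n w ∧ dumont w ∧ not (contains132 w) ∧ (occ12-3 w ≡ᵇ r))
                        (words n (map suc (upTo n))))

Series : Set
Series = ℕ → ℤ

Dgf : ℕ → Series
Dgf r n = + D r n

mul1-x² : Series → Series
mul1-x² f zero          = f zero
mul1-x² f (suc zero)    = f (suc zero)
mul1-x² f (suc (suc n)) = f (suc (suc n)) - f n

mul1-x²^ : ℕ → Series → Series
mul1-x²^ zero    f = f
mul1-x²^ (suc k) f = mul1-x² (mul1-x²^ k f)

poly : List ℤ → Series
poly []       n       = + 0
poly (c ∷ cs) zero    = c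
poly (c ∷ cs) (suc n) = poly cs n

shift : ℕ → Series → Series
shift zero    f n       = f n
shift (suc s) f zero    = + 0
shift (suc s) f (suc n) = shift s f n

{-# OPTIONS --safe #-}

-- A 132-avoiding Dumont permutation of [n+1] is X (n+1) R with every entry of X above every
-- entry of R, and X, R are again 132-avoiding Dumont permutations up to shifting values.  For
-- odd n+1, R is empty.  For even n+1, either X is empty, or R is nonempty of even length and X
-- has odd length 2a+1.  The occurrences of 12-3 add up, plus one for each ascent of X, of which
-- there are a.  Counting the pieces gives a recurrence for 𝒟_{12-3;r}(n), which for r ≤ 4 is
-- solved by explicit tables.  From n = 14 on the even terms satisfy
-- 𝒟_r(n) = 𝒟_r(n-2) + 𝒟_{r-1}(n-4) + 2 𝒟_{r-3}(n-6) and the odd ones vanish, so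
-- (1 - x²)^(r+1) 𝒟_r(x) is a polynomial; its coefficients are then computed.

module Submission where

open import Defs
open import Data.Nat using (ℕ)
open import Data.Integer using (+_; -_)
open import Data.List using (_∷_; [])
open import Data.Product using (_×_)
open import Relation.Binary.PropositionalEquality using (_≡_)

open import Data.Nat
  using (zero; suc; _<ᵇ_; _≡ᵇ_; _≤ᵇ_; _∸_; _+_; _*_; _<_; _≤_; z≤n; s≤s; z<s; _<?_)
open import Data.Nat.Properties
open import Data.Nat.Tactic.RingSolver using (solve-∀)
open import Data.Bool using (Bool; true; false; _∧_; _∨_; not; if_then_else_; T)
open import Data.Bool.Properties using (T?; ∧-assoc; ∨-assoc; ∨-identityʳ; ∧-zeroʳ; not-injective)
open import Data.Bool.ListAction using (all; any)
open import Data.Unit using (tt)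
open import Data.Empty using (⊥; ⊥-elim)
open import Data.List
  using (List; length; map; concatMap; upTo; downFrom; _++_; cartesianProductWith)
open import Data.List.Properties
  using (length-map; length-++; ∷-injective; ∷-injectiveˡ; ∷-injectiveʳ; map-injective; ++-cancelʳ)
open import Data.List.Relation.Unary.All as All using (All; []; _∷_)
import Data.List.Relation.Unary.All.Properties as All
open import Data.List.Relation.Unary.Any as Any using (here; there)
open import Data.List.Relation.Unary.AllPairs using ([]; _∷_)
open import Data.List.Relation.Unary.Unique.Propositional using (Unique)
import Data.List.Relation.Unary.Unique.Propositional.Properties as Unique
open import Data.List.Relation.Binary.Disjoint.Propositional using (Disjoint)
open import Data.List.Relation.Binary.Permutation.Propositional as ↭ using (_↭_)
open import Data.List.Relation.Binary.Permutation.Propositional.Properties using (↭-length)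
open import Data.List.Relation.Binary.BagAndSetEquality using (∼bag⇒↭)
open import Data.List.Membership.Propositional using (_∈_; find)
open import Data.List.Membership.Propositional.Properties
open import Data.List.Membership.Propositional.Properties.WithK using (unique∧set⇒bag)
open import Data.List.Membership.DecPropositional _≟_ using (_∈?_)
open import Data.Nat.Induction using (<-rec)
open import Data.Integer as ℤ using (ℤ)
import Data.Integer.Properties as ℤ
import Data.Integer.Tactic.RingSolver as ℤ-Solver
open import Data.Product using (_,_; proj₁; proj₂; ∃)
open import Data.Sum using (_⊎_; inj₁; inj₂)
open import Function.Bundles using (mk⇔)
open import Relation.Binary.PropositionalEquality
  using (_≢_; refl; sym; trans; cong; cong₂; subst; module ≡-Reasoning)
open import Relation.Binary using (tri<; tri≈; tri>; DecidableEquality)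
open import Relation.Nullary using (yes; no; does)

∧-trueˡ : ∀ {a b} → a ∧ b ≡ true → a ≡ true
∧-trueˡ {true} _ = refl

∧-trueʳ : ∀ {a b} → a ∧ b ≡ true → b ≡ true
∧-trueʳ {true} e = e

∧-true : ∀ {a b} → a ≡ true → b ≡ true → a ∧ b ≡ true
∧-true refl refl = refl

∨-falseˡ : ∀ {a b} → a ∨ b ≡ false → a ≡ false
∨-falseˡ {false} _ = refl

∨-falseʳ : ∀ {a b} → a ∨ b ≡ false → b ≡ false
∨-falseʳ {false} e = e

∨-false : ∀ {a b} → a ≡ false → b ≡ false → a ∨ b ≡ false
∨-false refl refl = refl

∧-falseˡ : ∀ {a} b → a ≡ false → a ∧ b ≡ false
∧-falseˡ b refl = refl

true≢false : true ≢ false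
true≢false ()

T⇒≡true : ∀ {b} → T b → b ≡ true
T⇒≡true {true} _ = refl

≡true⇒T : ∀ {b} → b ≡ true → T b
≡true⇒T refl = tt

<ᵇ-true : ∀ {a b} → a < b → (a <ᵇ b) ≡ true
<ᵇ-true a<b = T⇒≡true (<⇒<ᵇ a<b)

<ᵇ-true⁻ : ∀ {a b} → (a <ᵇ b) ≡ true → a < b
<ᵇ-true⁻ {a} {b} e = <ᵇ⇒< a b (≡true⇒T e)

<ᵇ-false : ∀ {a b} → b ≤ a → (a <ᵇ b) ≡ false
<ᵇ-false {a} {b} b≤a with a <ᵇ b in eq
... | false = refl
... | true  = ⊥-elim (<⇒≱ (<ᵇ-true⁻ eq) b≤a)

≡ᵇ-true : ∀ {a b} → a ≡ b → (a ≡ᵇ b) ≡ true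
≡ᵇ-true {a} {b} a≡b = T⇒≡true (≡⇒≡ᵇ a b a≡b)

≡ᵇ-true⁻ : ∀ {a b} → (a ≡ᵇ b) ≡ true → a ≡ b
≡ᵇ-true⁻ {a} {b} e = ≡ᵇ⇒≡ a b (≡true⇒T e)

≡ᵇ-false : ∀ {a b} → a ≢ b → (a ≡ᵇ b) ≡ false
≡ᵇ-false {a} {b} a≢b with a ≡ᵇ b in eq
... | false = refl
... | true  = ⊥-elim (a≢b (≡ᵇ-true⁻ eq))

≡ᵇ-false⁻ : ∀ {a b} → (a ≡ᵇ b) ≡ false → a ≢ b
≡ᵇ-false⁻ {a} e refl = true≢false (trans (sym (≡ᵇ-true {a} refl)) e)

all-true⁻ : ∀ {p : ℕ → Bool} xs → all p xs ≡ true → All (λ x → p x ≡ true) xs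
all-true⁻ []       _ = []
all-true⁻ (x ∷ xs) e = ∧-trueˡ e ∷ all-true⁻ xs (∧-trueʳ e)

all-true : ∀ {p : ℕ → Bool} {xs} → All (λ x → p x ≡ true) xs → all p xs ≡ true
all-true []         = refl
all-true (px ∷ pxs) = ∧-true px (all-true pxs)

any-false⁻ : ∀ {p : ℕ → Bool} xs → any p xs ≡ false → All (λ x → p x ≡ false) xs
any-false⁻ []       _ = []
any-false⁻ (x ∷ xs) e = ∨-falseˡ e ∷ any-false⁻ xs (∨-falseʳ e)

any-false : ∀ {p : ℕ → Bool} {xs} → All (λ x → p x ≡ false) xs → any p xs ≡ false
any-false []         = refl
any-false (px ∷ pxs) = ∨-false px (any-false pxs)

Unique-concatMap : ∀ {A B : Set} (g : A → List B) {xs} → Unique xs → (∀ {a} → a ∈ xs → Unique (g a)) →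
                   (∀ {a b} → a ∈ xs → b ∈ xs → a ≢ b → Disjoint (g a) (g b)) → Unique (concatMap g xs)
Unique-concatMap g {[]}     _         _  _  = []
Unique-concatMap g {x ∷ xs} (x∉ ∷ u) ug dg =
  Unique.++⁺ (ug (here refl)) (Unique-concatMap g u (λ a∈ → ug (there a∈)) (λ a∈ b∈ → dg (there a∈) (there b∈)))
    λ (v∈gx , v∈rest) → let (y , y∈ , v∈gy) = find (∈-concatMap⁻ g {xs = xs} v∈rest)
                        in dg (here refl) (there y∈) (All.lookup x∉ y∈) (v∈gx , v∈gy)

Unique-map-on : ∀ {A B : Set} (g : A → B) {xs} → (∀ {a b} → a ∈ xs → b ∈ xs → g a ≡ g b → a ≡ b) →
                Unique xs → Unique (map g xs)
Unique-map-on g {[]}     inj u       = []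
Unique-map-on g {x ∷ xs} inj (h ∷ u) =
  All.map⁺ (All.tabulate (λ {b} b∈ e → All.lookup h b∈ (inj (here refl) (there b∈) e)))
  ∷ Unique-map-on g (λ p q → inj (there p) (there q)) u

Unique-cartesianProductWith-on :
  ∀ {A B C : Set} (f : A → B → C) {xs ys} →
  (∀ {a a' b b'} → a ∈ xs → a' ∈ xs → b ∈ ys → b' ∈ ys → f a b ≡ f a' b' → a ≡ a' × b ≡ b') →
  Unique xs → Unique ys → Unique (cartesianProductWith f xs ys)
Unique-cartesianProductWith-on f {[]}          inj ux      uy = []
Unique-cartesianProductWith-on f {x ∷ xs} {ys} inj (h ∷ ux) uy =
  Unique.++⁺ (Unique-map-on (f x) (λ p q e → proj₂ (inj (here refl) (here refl) p q e)) uy)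
             (Unique-cartesianProductWith-on f (λ p p' → inj (there p) (there p')) ux uy)
             disjoint
  where
  disjoint : Disjoint (map (f x) ys) (cartesianProductWith f xs ys)
  disjoint (v∈₁ , v∈₂) with ∈-map⁻ (f x) v∈₁ | ∈-cartesianProductWith⁻ f xs ys v∈₂
  ... | b , b∈ , refl | a , b' , a∈ , b'∈ , e = All.lookup h a∈ (proj₁ (inj (here refl) (there a∈) b∈ b'∈ e))

Unique-++⁻ˡ : ∀ {xs ys : List ℕ} → Unique (xs ++ ys) → Unique xs
Unique-++⁻ˡ {[]}     _       = []
Unique-++⁻ˡ {x ∷ xs} (h ∷ u) = All.++⁻ˡ xs h ∷ Unique-++⁻ˡ u

Unique-++⁻ʳ : ∀ (xs : List ℕ) {ys} → Unique (xs ++ ys) → Unique ys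
Unique-++⁻ʳ []       u       = u
Unique-++⁻ʳ (x ∷ xs) (_ ∷ u) = Unique-++⁻ʳ xs u

Unique-++-disjoint : ∀ (xs : List ℕ) {ys x} → Unique (xs ++ ys) → x ∈ xs → x ∈ ys → ⊥
Unique-++-disjoint (y ∷ xs) (h ∷ u) (here refl) q = All.lookup (All.++⁻ʳ xs h) q refl
Unique-++-disjoint (y ∷ xs) (h ∷ u) (there p)   q = Unique-++-disjoint xs u p q

++-cancel-length : ∀ (xs xs' : List ℕ) {ys ys'} → xs ++ ys ≡ xs' ++ ys' → length xs ≡ length xs' →
                   xs ≡ xs' × ys ≡ ys'
++-cancel-length []       []         e _   = refl , e
++-cancel-length (x ∷ xs) (x' ∷ xs') e len with ∷-injective e
... | refl , e' with ++-cancel-length xs xs' e' (suc-injective len)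
... | refl , e'' = refl , e''

sumMap : (ℕ → ℕ) → List ℕ → ℕ
sumMap g []       = 0
sumMap g (x ∷ xs) = g x + sumMap g xs

sumMap-cong : ∀ {g h : ℕ → ℕ} xs → (∀ x → x ∈ xs → g x ≡ h x) → sumMap g xs ≡ sumMap h xs
sumMap-cong []       _ = refl
sumMap-cong (x ∷ xs) e = cong₂ _+_ (e x (here refl)) (sumMap-cong xs (λ y p → e y (there p)))

length-concatMap : ∀ {B : Set} (g : ℕ → List B) xs → length (concatMap g xs) ≡ sumMap (λ x → length (g x)) xs
length-concatMap g []       = refl
length-concatMap g (x ∷ xs) = trans (length-++ (g x)) (cong (_+_ (length (g x))) (length-concatMap g xs))

length-cartesianProductWith : ∀ {A B C : Set} (f : A → B → C) xs ys →
                              length (cartesianProductWith f xs ys) ≡ length xs * length ys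
length-cartesianProductWith f []       ys = refl
length-cartesianProductWith f (x ∷ xs) ys =
  trans (length-++ (map (f x) ys)) (cong₂ _+_ (length-map (f x) ys) (length-cartesianProductWith f xs ys))

Unique-length : {xs ys : List (List ℕ)} → Unique xs → Unique ys →
                (∀ {x} → x ∈ xs → x ∈ ys) → (∀ {x} → x ∈ ys → x ∈ xs) → length xs ≡ length ys
Unique-length ux uy to from = ↭-length (∼bag⇒↭ (unique∧set⇒bag ux uy (mk⇔ to from)))

∈-words⁺ : ∀ {A : List ℕ} n w → length w ≡ n → All (_∈ A) w → w ∈ words n A
∈-words⁺         zero    []      refl []         = here refl
∈-words⁺ {A = A} (suc n) (a ∷ w) refl (a∈ ∷ w⊆) =
  ∈-concatMap⁺ (λ b → map (b ∷_) (words n A))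
    (Any.map (λ { refl → ∈-map⁺ (a ∷_) (∈-words⁺ n w refl w⊆) }) a∈)

Unique-words : ∀ {A : List ℕ} n → Unique A → Unique (words n A)
Unique-words zero    _  = [] ∷ []
Unique-words {A} (suc n) uA =
  Unique-concatMap (λ a → map (a ∷_) (words n A)) uA
    (λ _ → Unique.map⁺ ∷-injectiveʳ (Unique-words n uA))
    (λ _ _ a≢b (p , q) → a≢b (same-head p q))
  where
  same-head : ∀ {a b v} → v ∈ map (a ∷_) (words n A) → v ∈ map (b ∷_) (words n A) → a ≡ b
  same-head p q with ∈-map⁻ _ p | ∈-map⁻ _ q
  ... | _ , _ , refl | _ , _ , e = ∷-injectiveˡ e

¬∈[] : ∀ {A : Set} {v : A} → v ∈ [] → ⊥
¬∈[] ()

∈-concatMap-at : ∀ {B : Set} (g : ℕ → List B) {xs x y} → x ∈ xs → y ∈ g x → y ∈ concatMap g xs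
∈-concatMap-at g x∈ y∈ = ∈-concatMap⁺ g (Any.map (λ { refl → y∈ }) x∈)

remove : ∀ {x : ℕ} {ys} → x ∈ ys → List ℕ
remove {ys = y ∷ ys} (here _)  = ys
remove {ys = y ∷ ys} (there p) = y ∷ remove p

length-remove : ∀ {x : ℕ} {ys} (p : x ∈ ys) → suc (length (remove p)) ≡ length ys
length-remove (here _)  = refl
length-remove (there p) = cong suc (length-remove p)

∈-remove : ∀ {x z : ℕ} {ys} (p : x ∈ ys) → z ∈ ys → z ≢ x → z ∈ remove p
∈-remove (here refl) (here refl) z≢x = ⊥-elim (z≢x refl)
∈-remove (here refl) (there q)   _   = q
∈-remove (there p)   (here refl) _   = here refl
∈-remove (there p)   (there q)   z≢x = there (∈-remove p q z≢x)

Unique-⊆⇒length-≤ : ∀ {xs ys : List ℕ} → Unique xs → (∀ {z} → z ∈ xs → z ∈ ys) → length xs ≤ length ys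
Unique-⊆⇒length-≤ {[]}     _       _   = z≤n
Unique-⊆⇒length-≤ {x ∷ xs} (h ∷ u) sub =
  subst (suc (length xs) ≤_) (length-remove x∈)
    (s≤s (Unique-⊆⇒length-≤ u (λ z∈ → ∈-remove x∈ (sub (there z∈)) (λ { refl → All.lookup h z∈ refl }))))
  where x∈ = sub (here refl)

-- Permutations of [n]

[1…_] : ℕ → List ℕ
[1… n ] = map suc (downFrom n)

InRange : ℕ → ℕ → Set
InRange n a = 0 < a × a ≤ n

length-[1…] : ∀ n → length [1… n ] ≡ n
length-[1…] zero    = refl
length-[1…] (suc n) = cong suc (length-[1…] n)

∈-[1…]⁺ : ∀ {n a} → InRange n a → a ∈ [1… n ]
∈-[1…]⁺ {a = suc a} (_ , a≤n) = ∈-map⁺ suc (∈-downFrom⁺ a≤n)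

∈-[1…]⁻ : ∀ {n a} → a ∈ [1… n ] → InRange n a
∈-[1…]⁻ a∈ with ∈-map⁻ suc a∈
... | b , b∈ , refl = s≤s z≤n , ∈-downFrom⁻ b∈

[1…]-unique : ∀ n → Unique [1… n ]
[1…]-unique n = Unique.map⁺ suc-injective (Unique.downFrom⁺ n)

Perm : ℕ → List ℕ → Set
Perm n w = length w ≡ n × All (InRange n) w × Unique w

distinct⇒Unique : ∀ w → distinct w ≡ true → Unique w
distinct⇒Unique []      _ = []
distinct⇒Unique (a ∷ w) e =
  All.map (λ h → ≡ᵇ-false⁻ (not-injective h)) (all-true⁻ w (∧-trueˡ e)) ∷ distinct⇒Unique w (∧-trueʳ e)

Unique⇒distinct : ∀ {w} → Unique w → distinct w ≡ true
Unique⇒distinct []      = refl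
Unique⇒distinct (h ∷ u) = ∧-true (all-true (All.map (λ a≢b → cong not (≡ᵇ-false a≢b)) h)) (Unique⇒distinct u)

isPerm⇒Perm : ∀ n w → isPerm n w ≡ true → Perm n w
isPerm⇒Perm n w e =
  ≡ᵇ-true⁻ (∧-trueˡ e) ,
  All.map (λ r → <ᵇ-true⁻ (∧-trueˡ r) , ≤-pred (<ᵇ-true⁻ (∧-trueʳ r))) (all-true⁻ w (∧-trueˡ rest)) ,
  distinct⇒Unique w (∧-trueʳ rest)
  where
  rest = ∧-trueʳ {length w ≡ᵇ n} e

Perm⇒isPerm : ∀ n w → Perm n w → isPerm n w ≡ true
Perm⇒isPerm n w (len , range , u) =
  ∧-true {length w ≡ᵇ n} (≡ᵇ-true len)
    (∧-true (all-true (All.map (λ (0<a , a≤n) → ∧-true (<ᵇ-true 0<a) (<ᵇ-true (s≤s a≤n))) range))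
            (Unique⇒distinct u))

Perm-∈ : ∀ {n w} → Perm n w → ∀ {a} → InRange n a → a ∈ w
Perm-∈ {n} {w} (len , range , u) {a} a∈n with a ∈? w
... | yes a∈w = a∈w
... | no  a∉w = ⊥-elim (<-irrefl refl (≤-trans
        (subst (λ t → suc t ≤ length [1… n ]) len
          (Unique-⊆⇒length-≤ (All.tabulate (λ {z} z∈ a≡z → a∉w (subst (_∈ w) (sym a≡z) z∈)) ∷ u)
            (λ { (here refl) → ∈-[1…]⁺ a∈n ; (there z∈) → ∈-[1…]⁺ (All.lookup range z∈) })))
        (≤-reflexive (length-[1…] n))))

Perm⇒↭ : ∀ {n w} → Perm n w → w ↭ [1… n ]
Perm⇒↭ {n} p@(_ , range , u) =
  ∼bag⇒↭ (unique∧set⇒bag u ([1…]-unique n)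
    (mk⇔ (λ a∈ → ∈-[1…]⁺ (All.lookup range a∈)) (λ a∈ → Perm-∈ p (∈-[1…]⁻ a∈))))

double : ℕ → ℕ
double zero    = 0
double (suc j) = suc (suc (double j))

≤⇒≡+ : ∀ {m n} → m ≤ n → ∃ λ k → n ≡ m + k
≤⇒≡+ z≤n       = _ , refl
≤⇒≡+ (s≤s m≤n) with ≤⇒≡+ m≤n
... | k , refl = k , refl

parity : ∀ n → (∃ λ j → n ≡ double j) ⊎ (∃ λ j → n ≡ suc (double j))
parity zero             = inj₁ (0 , refl)
parity (suc zero)       = inj₂ (0 , refl)
parity (suc (suc n)) with parity n
... | inj₁ (j , refl) = inj₁ (suc j , refl)
... | inj₂ (j , refl) = inj₂ (suc j , refl)

double-+ : ∀ a b → double a + double b ≡ double (a + b)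
double-+ zero    b = refl
double-+ (suc a) b = cong (λ t → suc (suc t)) (double-+ a b)

double-injective : ∀ {a b} → double a ≡ double b → a ≡ b
double-injective {zero}  {zero}  _ = refl
double-injective {suc a} {suc b} e = cong suc (double-injective (suc-injective (suc-injective e)))

double≢suc-double : ∀ a b → double a ≢ suc (double b)
double≢suc-double (suc (suc a)) zero    ()
double≢suc-double (suc a)       (suc b) e = double≢suc-double a b (suc-injective (suc-injective e))

double-mono-≤ : ∀ {a b} → a ≤ b → double a ≤ double b
double-mono-≤ z≤n       = z≤n
double-mono-≤ (s≤s a≤b) = s≤s (s≤s (double-mono-≤ a≤b))

-- Shifting words and splitting them at the maximum

raise : ℕ → List ℕ → List ℕ
raise k = map (_+_ k)

dumontStep : ℕ → ℕ → Bool
dumontStep a b = if isEven a then b <ᵇ a else a <ᵇ b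

ascents : List ℕ → ℕ
ascents []          = 0
ascents (a ∷ [])    = 0
ascents (a ∷ b ∷ w) = (if a <ᵇ b then 1 else 0) + ascents (b ∷ w)

oddCount : List ℕ → ℕ
oddCount = countᵇ (λ a → not (isEven a))

Above : List ℕ → List ℕ → Set
Above X R = All (λ x → All (_< x) R) X

<ᵇ-raise : ∀ k a b → ((k + a) <ᵇ (k + b)) ≡ (a <ᵇ b)
<ᵇ-raise zero    a b = refl
<ᵇ-raise (suc k) a b = <ᵇ-raise k a b

isEven-double+ : ∀ j a → isEven (double j + a) ≡ isEven a
isEven-double+ zero    a = refl
isEven-double+ (suc j) a = isEven-double+ j a

isEven-double : ∀ m → isEven (double m) ≡ true
isEven-double zero    = refl
isEven-double (suc m) = isEven-double m

isEven-suc-double : ∀ m → isEven (suc (double m)) ≡ false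
isEven-suc-double zero    = refl
isEven-suc-double (suc m) = isEven-suc-double m

dumont-raise : ∀ j w → dumont (raise (double j) w) ≡ dumont w
dumont-raise j []          = refl
dumont-raise j (a ∷ [])    = cong not (isEven-double+ j a)
dumont-raise j (a ∷ b ∷ w) = cong₂ _∧_ step (dumont-raise j (b ∷ w))
  where
  step : dumontStep (double j + a) (double j + b) ≡ dumontStep a b
  step rewrite isEven-double+ j a | <ᵇ-raise (double j) a b | <ᵇ-raise (double j) b a = refl

countᵇ-raise : ∀ k b w → countᵇ (λ c → (k + b) <ᵇ c) (raise k w) ≡ countᵇ (λ c → b <ᵇ c) w
countᵇ-raise k b []      = refl
countᵇ-raise k b (c ∷ w) = cong₂ _+_ (cong (λ t → if t then 1 else 0) (<ᵇ-raise k b c)) (countᵇ-raise k b w)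

occ12-3-raise : ∀ k w → occ12-3 (raise k w) ≡ occ12-3 w
occ12-3-raise k []          = refl
occ12-3-raise k (a ∷ [])    = refl
occ12-3-raise k (a ∷ b ∷ w) =
  cong₂ _+_ (cong₂ (λ t u → if t then u else 0) (<ᵇ-raise k a b) (countᵇ-raise k b w)) (occ12-3-raise k (b ∷ w))

ascents-raise : ∀ k w → ascents (raise k w) ≡ ascents w
ascents-raise k []          = refl
ascents-raise k (a ∷ [])    = refl
ascents-raise k (a ∷ b ∷ w) = cong₂ _+_ (cong (λ t → if t then 1 else 0) (<ᵇ-raise k a b)) (ascents-raise k (b ∷ w))

has21Above-raise : ∀ k a w → has21Above (k + a) (raise k w) ≡ has21Above a w
has21Above-raise k a []      = refl
has21Above-raise k a (b ∷ w) = cong₂ _∨_ (any-raise w) (has21Above-raise k a w)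
  where
  any-raise : ∀ w → any (λ c → ((k + a) <ᵇ c) ∧ (c <ᵇ (k + b))) (raise k w)
                  ≡ any (λ c → (a <ᵇ c) ∧ (c <ᵇ b)) w
  any-raise []      = refl
  any-raise (c ∷ w) = cong₂ _∨_ (cong₂ _∧_ (<ᵇ-raise k a c) (<ᵇ-raise k c b)) (any-raise w)

contains132-raise : ∀ k w → contains132 (raise k w) ≡ contains132 w
contains132-raise k []      = refl
contains132-raise k (a ∷ w) = cong₂ _∨_ (has21Above-raise k a w) (contains132-raise k w)

countᵇ-++ : ∀ (p : ℕ → Bool) xs ys → countᵇ p (xs ++ ys) ≡ countᵇ p xs + countᵇ p ys
countᵇ-++ p []       ys = refl
countᵇ-++ p (x ∷ xs) ys =
  trans (cong (_+_ (if p x then 1 else 0)) (countᵇ-++ p xs ys)) (sym (+-assoc (if p x then 1 else 0) _ _))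

countᵇ-none : ∀ {p : ℕ → Bool} {xs} → All (λ c → p c ≡ false) xs → countᵇ p xs ≡ 0
countᵇ-none []           = refl
countᵇ-none (px ∷ pxs) rewrite px = countᵇ-none pxs

countᵇ-↭ : ∀ (p : ℕ → Bool) {xs ys} → xs ↭ ys → countᵇ p xs ≡ countᵇ p ys
countᵇ-↭ p ↭.refl          = refl
countᵇ-↭ p (↭.prep x q)    = cong (_+_ _) (countᵇ-↭ p q)
countᵇ-↭ p (↭.swap {ys = ys} x y q) rewrite countᵇ-↭ p q =
  +-comm-middle (if p x then 1 else 0) (if p y then 1 else 0) (countᵇ p ys)
  where
  +-comm-middle : ∀ a b c → a + (b + c) ≡ b + (a + c)
  +-comm-middle = solve-∀
countᵇ-↭ p (↭.trans q q')  = trans (countᵇ-↭ p q) (countᵇ-↭ p q')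

any-++ : ∀ (p : ℕ → Bool) xs ys → any p (xs ++ ys) ≡ any p xs ∨ any p ys
any-++ p []       ys = refl
any-++ p (x ∷ xs) ys rewrite any-++ p xs ys = sym (∨-assoc (p x) _ _)

dumont-++-max : ∀ N R X → All (_< N) X → dumont (X ++ N ∷ R) ≡ dumont X ∧ dumont (N ∷ R)
dumont-++-max N R []          _              = refl
dumont-++-max N R (x ∷ [])    (x<N ∷ []) with isEven x
... | true  rewrite <ᵇ-false {N} {x} (<⇒≤ x<N) = refl
... | false rewrite <ᵇ-true x<N = refl
dumont-++-max N R (x ∷ y ∷ X) (_ ∷ y∷X<N) rewrite dumont-++-max N R (y ∷ X) y∷X<N =
  sym (∧-assoc (dumontStep x y) _ _)

has21Above-below : ∀ a R → All (_< a) R → has21Above a R ≡ false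
has21Above-below a []      _           = refl
has21Above-below a (b ∷ R) (b<a ∷ R<a) =
  ∨-false (any-false (All.map (λ {c} c<a → ∧-falseˡ (c <ᵇ b) (<ᵇ-false (<⇒≤ c<a))) R<a)) (has21Above-below a R R<a)

has21Above-++-max : ∀ a N R X → All (_< N) X → All (_< a) R → has21Above a (X ++ N ∷ R) ≡ has21Above a X
has21Above-++-max a N R []      _            R<a =
  ∨-false (any-false (All.map (λ {c} c<a → ∧-falseˡ (c <ᵇ N) (<ᵇ-false (<⇒≤ c<a))) R<a)) (has21Above-below a R R<a)
has21Above-++-max a N R (b ∷ X) (b<N ∷ X<N) R<a = cong₂ _∨_ any-eq (has21Above-++-max a N R X X<N R<a)
  where
  p = λ c → (a <ᵇ c) ∧ (c <ᵇ b)
  any-eq : any p (X ++ N ∷ R) ≡ any p X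
  any-eq rewrite any-++ p X (N ∷ R) | <ᵇ-false {N} {b} (<⇒≤ b<N) | ∧-zeroʳ (a <ᵇ N)
               | any-false {p} {R} (All.map (λ {c} c<a → ∧-falseˡ (c <ᵇ b) (<ᵇ-false (<⇒≤ c<a))) R<a) =
    ∨-identityʳ (any p X)

contains132-++-max : ∀ N R X → All (_< N) X → All (_< N) R → Above X R →
                     contains132 (X ++ N ∷ R) ≡ contains132 X ∨ contains132 R
contains132-++-max N R []      _           R<N _              rewrite has21Above-below N R R<N = refl
contains132-++-max N R (x ∷ X) (x<N ∷ X<N) R<N (R<x ∷ X>R)
  rewrite has21Above-++-max x N R X X<N R<x | contains132-++-max N R X X<N R<N X>R =
  sym (∨-assoc (has21Above x X) _ _)

occ12-3-max∷ : ∀ N R → All (_< N) R → occ12-3 (N ∷ R) ≡ occ12-3 R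
occ12-3-max∷ N []      _         = refl
occ12-3-max∷ N (c ∷ R) (c<N ∷ _) rewrite <ᵇ-false {N} {c} (<⇒≤ c<N) = refl

-- Every ascent of X becomes an occurrence of 12-3 whose 3 is the maximum N.
occ12-3-++-max : ∀ N R X → All (_< N) X → All (_< N) R → Above X R →
                 occ12-3 (X ++ N ∷ R) ≡ occ12-3 X + ascents X + occ12-3 R
occ12-3-++-max N R []          _                R<N _ = occ12-3-max∷ N R R<N
occ12-3-++-max N R (x ∷ [])    (x<N ∷ [])       R<N _
  rewrite countᵇ-none {λ c → N <ᵇ c} {R} (All.map (λ c<N → <ᵇ-false (<⇒≤ c<N)) R<N) | occ12-3-max∷ N R R<N
  with x <ᵇ N
... | true  = refl
... | false = refl
occ12-3-++-max N R (x ∷ y ∷ X) (x<N ∷ y<N ∷ X<N) R<N (_ ∷ R<y ∷ X>R)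
  rewrite occ12-3-++-max N R (y ∷ X) (y<N ∷ X<N) R<N (R<y ∷ X>R)
        | countᵇ-++ (λ c → y <ᵇ c) X (N ∷ R) | <ᵇ-true y<N
        | countᵇ-none {λ c → y <ᵇ c} {R} (All.map (λ c<y → <ᵇ-false (<⇒≤ c<y)) R<y)
  with x <ᵇ y
... | true  = regroup (countᵇ (λ c → y <ᵇ c) X) (occ12-3 (y ∷ X)) (ascents (y ∷ X)) (occ12-3 R)
  where
  regroup : ∀ c o s t → (c + 1) + (o + s + t) ≡ (c + o) + (1 + s) + t
  regroup = solve-∀
... | false = refl

-- In a Dumont word the ascents are exactly the odd entries other than the last one.
ascents-dumont : ∀ a X → dumont (a ∷ X) ≡ true → suc (ascents (a ∷ X)) ≡ oddCount (a ∷ X)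
ascents-dumont a []      e rewrite e = refl
ascents-dumont a (b ∷ X) e with isEven a
... | true  rewrite <ᵇ-false {a} {b} (<⇒≤ (<ᵇ-true⁻ (∧-trueˡ e))) = ascents-dumont b X (∧-trueʳ e)
... | false rewrite ∧-trueˡ {a <ᵇ b} e = cong suc (ascents-dumont b X (∧-trueʳ e))

oddCount-[1…double] : ∀ m → oddCount [1… double m ] ≡ m
oddCount-[1…double] zero    = refl
oddCount-[1…double] (suc m) rewrite isEven-double m | isEven-suc-double m = cong suc (oddCount-[1…double] m)

oddCount-[1…suc-double] : ∀ m → oddCount [1… suc (double m) ] ≡ suc m
oddCount-[1…suc-double] m rewrite isEven-suc-double m = cong suc (oddCount-[1…double] m)

ascents-dumont-odd : ∀ a L → Perm (suc (double a)) L → dumont L ≡ true → ascents L ≡ a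
ascents-dumont-odd a []      (() , _) _
ascents-dumont-odd a (b ∷ L) p        d =
  suc-injective (trans (ascents-dumont b L d) (trans (countᵇ-↭ _ (Perm⇒↭ p)) (oddCount-[1…suc-double] a)))

ascents-dumont-even : ∀ m X → Perm (double m) X → dumont X ≡ true → ascents X ≡ m ∸ 1
ascents-dumont-even zero    []      _        _ = refl
ascents-dumont-even zero    (_ ∷ _) (() , _) _
ascents-dumont-even (suc m) []      (() , _) _
ascents-dumont-even (suc m) (b ∷ X) p        d =
  suc-injective (trans (ascents-dumont b X d) (trans (countᵇ-↭ _ (Perm⇒↭ p)) (oddCount-[1…double] (suc m))))

-- 132-avoiding Dumont permutations split at their maximum

record Dumont132 (r n : ℕ) (w : List ℕ) : Set where
  constructor dumont132
  field
    perm        : Perm n w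
    isDumont    : dumont w ≡ true
    avoids132   : contains132 w ≡ false
    occurrences : occ12-3 w ≡ r

record MaxSplit (r n : ℕ) (X R : List ℕ) : Set where
  field
    lowerPerm   : Perm (length R) R
    upperRange  : All (λ x → length R < x × x ≤ n) X
    upperUnique : Unique X
    lengths     : length X + length R ≡ n
    dumontX     : dumont X ≡ true
    dumontMaxR  : dumont (suc n ∷ R) ≡ true
    avoidsX     : contains132 X ≡ false
    avoidsR     : contains132 R ≡ false
    occurrences : occ12-3 X + ascents X + occ12-3 R ≡ r

  length-R≤n : length R ≤ n
  length-R≤n = subst (length R ≤_) lengths (m≤n+m (length R) (length X))

  R<max : All (_< suc n) R
  R<max = All.map (λ (_ , c≤k) → s≤s (≤-trans c≤k length-R≤n)) (proj₁ (proj₂ lowerPerm))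

  X<max : All (_< suc n) X
  X<max = All.map (λ (_ , x≤n) → s≤s x≤n) upperRange

  X-above-R : Above X R
  X-above-R = All.map (λ (k<x , _) → All.map (λ (_ , c≤k) → ≤-<-trans c≤k k<x) (proj₁ (proj₂ lowerPerm))) upperRange

join-at-max : ∀ {r n X R} → MaxSplit r n X R → Dumont132 r (suc n) (X ++ suc n ∷ R)
join-at-max {r} {n} {X} {R} s = dumont132 (len , range , uniq) dum avoid
  (trans (occ12-3-++-max (suc n) R X X<max R<max X-above-R) occurrences)
  where
  open MaxSplit s
  len : length (X ++ suc n ∷ R) ≡ suc n
  len = trans (length-++ X) (trans (+-suc (length X) (length R)) (cong suc lengths))
  range : All (InRange (suc n)) (X ++ suc n ∷ R)
  range = All.++⁺ (All.map (λ (k<x , x≤n) → ≤-<-trans z≤n k<x , m≤n⇒m≤1+n x≤n) upperRange)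
                  ((s≤s z≤n , ≤-refl) ∷ All.map (λ (0<c , c≤k) → 0<c , m≤n⇒m≤1+n (≤-trans c≤k length-R≤n))
                                               (proj₁ (proj₂ lowerPerm)))
  uniq : Unique (X ++ suc n ∷ R)
  uniq = Unique.++⁺ upperUnique (All.map (λ c<N N≡c → <-irrefl (sym N≡c) c<N) R<max ∷ proj₂ (proj₂ lowerPerm))
    (λ { (v∈X , here refl) → <-irrefl refl (All.lookup X<max v∈X)
       ; (v∈X , there v∈R) → <-irrefl refl (All.lookup (All.lookup X-above-R v∈X) v∈R) })
  dum : dumont (X ++ suc n ∷ R) ≡ true
  dum = trans (dumont-++-max (suc n) R X X<max) (∧-true dumontX dumontMaxR)
  avoid : contains132 (X ++ suc n ∷ R) ≡ false
  avoid = trans (contains132-++-max (suc n) R X X<max R<max X-above-R) (∨-false avoidsX avoidsR)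

below-max : ∀ {N} X R → Perm N (X ++ N ∷ R) → All (_< N) X × All (_< N) R
below-max {N} X R (_ , range , u) =
  All.tabulate (λ x∈ → ≤∧≢⇒< (proj₂ (All.lookup (proj₁ ranges) x∈))
                              (λ { refl → Unique-++-disjoint X u x∈ (here refl) })) ,
  All.tabulate (λ c∈ → ≤∧≢⇒< (proj₂ (All.lookup (All.tail (proj₂ ranges)) c∈))
                              (λ { refl → All.lookup N∉R c∈ refl }))
  where
  ranges = All.++⁻ X range
  N∉R : All (N ≢_) R
  N∉R with Unique-++⁻ʳ X u
  ... | N∉R ∷ _ = N∉R

avoids132-across-max : ∀ N R X {x c} → contains132 (X ++ N ∷ R) ≡ false → x ∈ X → c ∈ R → x < c → c < N → ⊥
avoids132-across-max N R (y ∷ X) {c = c} e (here refl) c∈ x<c c<N =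
  true≢false (trans (sym (cong₂ _∧_ (<ᵇ-true x<c) (<ᵇ-true c<N))) (All.lookup (any-false⁻ R (∨-falseˡ h)) c∈))
  where
  suffix : ∀ xs ys → has21Above y (xs ++ ys) ≡ false → has21Above y ys ≡ false
  suffix []       ys e = e
  suffix (x ∷ xs) ys e = suffix xs ys (∨-falseʳ {any _ (xs ++ ys)} e)
  h = suffix X (N ∷ R) (∨-falseˡ {has21Above y (X ++ N ∷ R)} e)
avoids132-across-max N R (y ∷ X) e (there x∈) c∈ x<c c<N =
  avoids132-across-max N R X (∨-falseʳ {has21Above y (X ++ N ∷ R)} e) x∈ c∈ x<c c<N

avoids132⇒Above : ∀ {N} X R → Unique (X ++ N ∷ R) → All (_< N) R → contains132 (X ++ N ∷ R) ≡ false → Above X R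
avoids132⇒Above {N} X R u R<N avoid = All.tabulate (λ x∈ → All.tabulate (λ c∈ → compare x∈ c∈))
  where
  compare : ∀ {x c} → x ∈ X → c ∈ R → c < x
  compare {x} {c} x∈ c∈ with <-cmp c x
  ... | tri< c<x _ _ = c<x
  ... | tri≈ _ refl _ = ⊥-elim (Unique-++-disjoint X u x∈ (there c∈))
  ... | tri> _ _ x<c = ⊥-elim (avoids132-across-max N R X avoid x∈ c∈ x<c (All.lookup R<N c∈))

-- Everything below an entry c of R lies in R, so c ≤ length R by pigeonhole.
lower-Perm : ∀ {N} X R → Perm N (X ++ N ∷ R) → All (_< N) R → Above X R → Perm (length R) R
lower-Perm {N} X R p@(_ , range , u) R<N X>R = refl , All.tabulate bound , unique
  where
  unique : Unique R
  unique with Unique-++⁻ʳ X u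
  ... | _ ∷ uR = uR
  bound : ∀ {c} → c ∈ R → InRange (length R) c
  bound {c} c∈ = proj₁ (All.lookup (All.++⁻ʳ X range) (there c∈)) ,
    subst (_≤ length R) (length-[1…] c) (Unique-⊆⇒length-≤ ([1…]-unique c) below-c)
    where
    below-c : ∀ {v} → v ∈ [1… c ] → v ∈ R
    below-c v∈ with ∈-[1…]⁻ v∈
    ... | 0<v , v≤c with ∈-++⁻ X (Perm-∈ p (0<v , ≤-trans v≤c (<⇒≤ (All.lookup R<N c∈))))
    ... | inj₁ v∈X         = ⊥-elim (<⇒≱ (All.lookup (All.lookup X>R v∈X) c∈) v≤c)
    ... | inj₂ (here refl) = ⊥-elim (<⇒≱ (All.lookup R<N c∈) v≤c)
    ... | inj₂ (there v∈R) = v∈R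

split-at-max : ∀ {r n w} → Dumont132 r (suc n) w → ∃ λ X → ∃ λ R → w ≡ X ++ suc n ∷ R × MaxSplit r n X R
split-at-max {r} {n} (dumont132 p@(len , range , u) d avoid occ) with ∈-∃++ (Perm-∈ p (s≤s z≤n , ≤-refl))
... | X , R , refl = X , R , refl , record
  { lowerPerm   = lowerPerm
  ; upperRange  = All.tabulate (λ x∈ → above-length x∈ , ≤-pred (All.lookup X<N x∈))
  ; upperUnique = Unique-++⁻ˡ u
  ; lengths     = suc-injective (trans (sym (+-suc (length X) (length R))) (trans (sym (length-++ X)) len))
  ; dumontX     = ∧-trueˡ dumont-parts
  ; dumontMaxR  = ∧-trueʳ {dumont X} dumont-parts
  ; avoidsX     = ∨-falseˡ avoid-parts
  ; avoidsR     = ∨-falseʳ {contains132 X} avoid-parts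
  ; occurrences = trans (sym (occ12-3-++-max (suc n) R X X<N R<N X>R)) occ
  }
  where
  X<N = proj₁ (below-max X R p)
  R<N = proj₂ (below-max X R p)
  X>R = avoids132⇒Above X R u R<N avoid
  lowerPerm = lower-Perm X R p R<N X>R
  above-length : ∀ {x} → x ∈ X → length R < x
  above-length {x} x∈ with length R <? x
  ... | yes k<x = k<x
  ... | no  k≮x = ⊥-elim (Unique-++-disjoint X u x∈
                    (there (Perm-∈ lowerPerm (proj₁ (All.lookup (All.++⁻ˡ X range) x∈) , ≮⇒≥ k≮x))))
  dumont-parts : dumont X ∧ dumont (suc n ∷ R) ≡ true
  dumont-parts = trans (sym (dumont-++-max (suc n) R X X<N)) d
  avoid-parts : contains132 X ∨ contains132 R ≡ false
  avoid-parts = trans (sym (contains132-++-max (suc n) R X X<N R<N X>R)) avoid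

glue : ℕ → ℕ → List ℕ → List ℕ → List ℕ
glue j N L R = raise (double j) L ++ N ∷ R

dumont-even-max∷ : ∀ m c R → All (_< double (suc m)) (c ∷ R) → dumont (c ∷ R) ≡ true →
                   dumont (double (suc m) ∷ c ∷ R) ≡ true
dumont-even-max∷ m c R (c<N ∷ _) d rewrite isEven-double (suc m) | <ᵇ-true c<N = d

Dumont132-empty : Dumont132 0 0 []
Dumont132-empty = dumont132 (refl , [] , []) refl refl refl

Dumont132-append-max : ∀ {r m X} → Dumont132 r (double m) X →
                       Dumont132 (r + (m ∸ 1)) (suc (double m)) (X ++ suc (double m) ∷ [])
Dumont132-append-max {r} {m} {X} (dumont132 p@(len , range , u) d avoid occ) = join-at-max record
  { lowerPerm   = refl , [] , []
  ; upperRange  = range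
  ; upperUnique = u
  ; lengths     = trans (+-identityʳ _) len
  ; dumontX     = d
  ; dumontMaxR  = cong not (isEven-suc-double m)
  ; avoidsX     = avoid
  ; avoidsR     = refl
  ; occurrences = trans (+-identityʳ _) (cong₂ _+_ occ (ascents-dumont-even m X p d))
  }

Dumont132-prepend-max : ∀ {r m R} → Dumont132 r (suc (double m)) R → Dumont132 r (double (suc m)) (double (suc m) ∷ R)
Dumont132-prepend-max {r} {m} {c ∷ R} (dumont132 (len , range , u) d avoid occ) = join-at-max record
  { lowerPerm   = refl , subst (λ n → All (InRange n) (c ∷ R)) (sym len) range , u
  ; upperRange  = []
  ; upperUnique = []
  ; lengths     = len
  ; dumontX     = refl
  ; dumontMaxR  = dumont-even-max∷ m c R (All.map (λ (_ , x≤n) → s≤s x≤n) range) d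
  ; avoidsX     = refl
  ; avoidsR     = avoid
  ; occurrences = occ
  }

Dumont132-glue : ∀ {r₁ r₂ a j m L R} → 0 < j → m ≡ a + j →
                 Dumont132 r₁ (suc (double a)) L → Dumont132 r₂ (double j) R →
                 Dumont132 (r₁ + a + r₂) (double (suc m)) (glue j (double (suc m)) L R)
Dumont132-glue {r₁} {r₂} {a} {suc j} {m} {L} {c ∷ R} z<s refl
               (dumont132 pL@(lenL , rangeL , uL) dL avoidL occL) (dumont132 (lenR , rangeR , uR) dR avoidR occR) =
  join-at-max record
  { lowerPerm   = refl , subst (λ n → All (InRange n) (c ∷ R)) (sym lenR) rangeR , uR
  ; upperRange  = All.map⁺ (All.map (λ {x} (0<x , x≤) →
                    subst (_< double (suc j) + x) (trans (+-identityʳ _) (sym lenR)) (+-monoʳ-< (double (suc j)) 0<x) ,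
                    subst (double (suc j) + x ≤_) sizes (+-monoʳ-≤ (double (suc j)) x≤)) rangeL)
  ; upperUnique = Unique.map⁺ (+-cancelˡ-≡ _ _ _) uL
  ; lengths     = trans (cong₂ _+_ (trans (length-map _ L) lenL) lenR) (trans (+-comm (suc (double a)) _) sizes)
  ; dumontX     = trans (dumont-raise (suc j) L) dL
  ; dumontMaxR  = dumont-even-max∷ (a + suc j) c R
                    (All.map (λ (_ , x≤) → s≤s (m≤n⇒m≤1+n (≤-trans x≤ R≤))) rangeR) dR
  ; avoidsX     = trans (contains132-raise _ L) avoidL
  ; avoidsR     = avoidR
  ; occurrences = cong₂ _+_ (cong₂ _+_ (trans (occ12-3-raise _ L) occL)
                                      (trans (ascents-raise _ L) (ascents-dumont-odd a L pL dL))) occR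
  }
  where
  sizes : double (suc j) + suc (double a) ≡ suc (double (a + suc j))
  sizes = trans (+-suc (double (suc j)) (double a)) (cong suc (trans (double-+ (suc j) a) (cong double (+-comm (suc j) a))))
  R≤ : double (suc j) ≤ double (a + suc j)
  R≤ = subst (double (suc j) ≤_) (double-+ a (suc j)) (m≤n+m (double (suc j)) (double a))

dumont-tail : ∀ a w → dumont (a ∷ w) ≡ true → dumont w ≡ true
dumont-tail a []      _ = refl
dumont-tail a (b ∷ w) d = ∧-trueʳ {dumontStep a b} d

dumont-suffix : ∀ Y Z → dumont (Y ++ Z) ≡ true → dumont Z ≡ true
dumont-suffix []      Z d = d
dumont-suffix (y ∷ Y) Z d = dumont-suffix Y Z (dumont-tail y (Y ++ Z) d)

-- An even entry must be followed by a smaller one, so the minimum of a Dumont word is odd.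
dumont-minimum-odd : ∀ {e} X → e ∈ X → All (e ≤_) X → dumont X ≡ true → isEven e ≡ false
dumont-minimum-odd {e} X e∈ e≤X d with ∈-∃++ e∈
... | Y , []    , refl = not-injective (dumont-suffix Y (e ∷ []) d)
... | Y , g ∷ Z , refl with isEven e in even
...   | false = refl
...   | true  = ⊥-elim (<⇒≱ (even-step even (∧-trueˡ {dumontStep e g} (dumont-suffix Y (e ∷ g ∷ Z) d)))
                            (All.lookup e≤X (∈-++⁺ʳ Y (there (here refl)))))
  where
  even-step : isEven e ≡ true → dumontStep e g ≡ true → g < e
  even-step ev step rewrite ev = <ᵇ-true⁻ step

unraise : ∀ k l X → All (λ x → k < x × x ≤ k + l) X → Unique X → length X ≡ l →
          Perm l (map (_∸ k) X) × raise k (map (_∸ k) X) ≡ X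
unraise k l X range u len =
  (trans (length-map _ X) len ,
   All.map⁺ (All.map (λ {x} (k<x , x≤) → m<n⇒0<n∸m k<x ,
                        subst (x ∸ k ≤_) (m+n∸m≡n k l) (∸-monoˡ-≤ k x≤)) range) ,
   Unique.map⁻ (subst Unique (sym raised) u)) ,
  raised
  where
  raise-∸ : ∀ Y → All (λ x → k < x × x ≤ k + l) Y → raise k (map (_∸ k) Y) ≡ Y
  raise-∸ []      []                = refl
  raise-∸ (y ∷ Y) ((k<y , _) ∷ rng) = cong₂ _∷_ (m+[n∸m]≡n (<⇒≤ k<y)) (raise-∸ Y rng)
  raised = raise-∸ X range

MaxSplit-upper : ∀ {r n X R} → MaxSplit r n X R →
                 Perm (length X) (map (_∸ length R) X) × raise (length R) (map (_∸ length R) X) ≡ X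
MaxSplit-upper {X = X} {R} s = unraise (length R) (length X) X
  (All.map (λ {y} (k<y , y≤n) → k<y , subst (y ≤_) (trans (sym lengths) (+-comm (length X) (length R))) y≤n) upperRange)
  upperUnique refl
  where open MaxSplit s

record Unglued (r m : ℕ) (X R : List ℕ) : Set where
  field
    a j r₁ r₂ : ℕ
    L         : List ℕ
    sizes     : m ≡ a + suc j
    counts    : r ≡ r₁ + a + r₂
    raised    : raise (double (suc j)) L ≡ X
    left      : Dumont132 r₁ (suc (double a)) L
    right     : Dumont132 r₂ (double (suc j)) R

-- The part R below the maximum has even length: otherwise 1 + length R, an even number,
-- would be the minimum of the part above it.
MaxSplit-lower-even : ∀ {r n x X R} → MaxSplit r n (x ∷ X) R → ∃ λ j → length R ≡ double j
MaxSplit-lower-even {x = x} {X} {R} s with parity (length R)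
... | inj₁ even   = even
... | inj₂ (j , k≡) =
  ⊥-elim (true≢false (trans (sym (isEven-double (suc j))) (dumont-minimum-odd (x ∷ X) k+1∈ k+1≤ dumontX)))
  where
  open MaxSplit s
  k = length R
  upperPieces = MaxSplit-upper s
  k+1∈ : double (suc j) ∈ x ∷ X
  k+1∈ = subst (_∈ x ∷ X) (trans (+-comm k 1) (cong suc k≡))
           (subst (k + 1 ∈_) (proj₂ upperPieces) (∈-map⁺ (_+_ k) (Perm-∈ (proj₁ upperPieces) (z<s , s≤s z≤n))))
  k+1≤ : All (double (suc j) ≤_) (x ∷ X)
  k+1≤ = All.map (λ {y} (k<y , _) → subst (_≤ y) (cong suc k≡) k<y) upperRange

unglue : ∀ {r m x X c R} → MaxSplit r (suc (double m)) (x ∷ X) (c ∷ R) → Unglued r m (x ∷ X) (c ∷ R)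
unglue {r} {m} {x} {X} {c} {R} s with MaxSplit-lower-even s
... | suc j , k≡ with parity (length (x ∷ X))
...   | inj₁ (a , l≡) = ⊥-elim (double≢suc-double (a + suc j) m
          (trans (sym (double-+ a (suc j))) (trans (cong₂ _+_ (sym l≡) (sym k≡)) (MaxSplit.lengths s))))
...   | inj₂ (a , l≡) = record
  { a = a ; j = j ; r₁ = occ12-3 L ; r₂ = occ12-3 (c ∷ R) ; L = L
  ; sizes  = sym a+j+1≡m
  ; counts = sym (trans (cong (λ t → t + a + occ12-3 (c ∷ R)) (sym occ-L))
                 (trans (cong (λ t → occ12-3 (x ∷ X) + t + occ12-3 (c ∷ R)) (sym ascents-L)) occurrences))
  ; raised = raised
  ; left   = dumont132 permL dumontL (trans (sym (contains132-raise _ L)) (trans (cong contains132 raised) avoidsX)) refl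
  ; right  = dumont132 (k≡ , subst (λ n → All (InRange n) (c ∷ R)) k≡ (proj₁ (proj₂ lowerPerm)) ,
                        proj₂ (proj₂ lowerPerm))
                       (dumont-tail (double (suc m)) (c ∷ R) dumontMaxR) avoidsR refl
  }
  where
  open MaxSplit s
  k = length (c ∷ R)
  upperPieces = MaxSplit-upper s
  a+j+1≡m : a + suc j ≡ m
  a+j+1≡m = double-injective (suc-injective
    (trans (cong suc (sym (double-+ a (suc j)))) (trans (cong₂ _+_ (sym l≡) (sym k≡)) lengths)))
  L = map (_∸ k) (x ∷ X)
  raised : raise (double (suc j)) L ≡ x ∷ X
  raised = subst (λ t → raise t L ≡ x ∷ X) k≡ (proj₂ upperPieces)
  permL : Perm (suc (double a)) L
  permL = subst (λ n → Perm n L) l≡ (proj₁ upperPieces)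
  dumontL : dumont L ≡ true
  dumontL = trans (sym (dumont-raise (suc j) L)) (trans (cong dumont raised) dumontX)
  occ-L : occ12-3 (x ∷ X) ≡ occ12-3 L
  occ-L = trans (cong occ12-3 (sym raised)) (occ12-3-raise _ L)
  ascents-L : ascents (x ∷ X) ≡ a
  ascents-L = trans (cong ascents (sym raised)) (trans (ascents-raise _ L) (ascents-dumont-odd a L permL dumontL))

-- Enumeration

-- evens fuel r m lists the 132-avoiding Dumont permutations of length 2m with r occurrences
-- of 12-3, and odds fuel r m those of length 2m+1 (fuel ≥ length suffices).  One of odd length
-- ends with its maximum; one of length 2m+2 starts with its maximum, or is a raised one of
-- length 2a+1 followed by the maximum and one of length 2(m-a).
mutual
  evens : ℕ → ℕ → ℕ → List (List ℕ)
  evens fuel       r zero    = if r ≡ᵇ 0 then [] ∷ [] else []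
  evens zero       r (suc m) = []
  evens (suc fuel) r (suc m) =
    map (double (suc m) ∷_) (odds fuel r m) ++ concatMap (evensSplitAt fuel r m) (upTo (suc r))

  evensSplitAt : ℕ → ℕ → ℕ → ℕ → List (List ℕ)
  evensSplitAt fuel r m a =
    if a <ᵇ m then concatMap (evensSplitWith fuel r m a) (upTo (suc (r ∸ a))) else []

  evensSplitWith : ℕ → ℕ → ℕ → ℕ → ℕ → List (List ℕ)
  evensSplitWith fuel r m a r₁ =
    cartesianProductWith (glue (m ∸ a) (double (suc m))) (odds fuel r₁ a) (evens fuel (r ∸ a ∸ r₁) (m ∸ a))

  odds : ℕ → ℕ → ℕ → List (List ℕ)
  odds zero       r m = []
  odds (suc fuel) r m =
    if (m ∸ 1) <ᵇ suc r then map (_++ suc (double m) ∷ []) (evens fuel (r ∸ (m ∸ 1)) m) else []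

∈-evensSplitAt⁻ : ∀ fuel r m a {w} → w ∈ evensSplitAt fuel r m a →
                  a < m × ∃ λ r₁ → r₁ ≤ r ∸ a × ∃ λ L → ∃ λ R →
                  L ∈ odds fuel r₁ a × R ∈ evens fuel (r ∸ a ∸ r₁) (m ∸ a) × w ≡ glue (m ∸ a) (double (suc m)) L R
∈-evensSplitAt⁻ fuel r m a w∈ with a <ᵇ m in a<ᵇm
... | false = ⊥-elim (¬∈[] w∈)
... | true with find (∈-concatMap⁻ (evensSplitWith fuel r m a) {xs = upTo (suc (r ∸ a))} w∈)
...   | r₁ , r₁∈ , w∈′
  with ∈-cartesianProductWith⁻ (glue (m ∸ a) (double (suc m))) (odds fuel r₁ a) (evens fuel (r ∸ a ∸ r₁) (m ∸ a)) w∈′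
...     | L , R , L∈ , R∈ , refl = <ᵇ-true⁻ a<ᵇm , r₁ , ≤-pred (∈-upTo⁻ r₁∈) , L , R , L∈ , R∈ , refl

mutual
  evens-sound : ∀ fuel r m {w} → w ∈ evens fuel r m → Dumont132 r (double m) w
  evens-sound fuel       zero    zero    (here refl) = Dumont132-empty
  evens-sound (suc fuel) r       (suc m) w∈ with ∈-++⁻ (map (double (suc m) ∷_) (odds fuel r m)) w∈
  ... | inj₁ w∈₁ with ∈-map⁻ (double (suc m) ∷_) w∈₁
  ... | R , R∈ , refl = Dumont132-prepend-max (odds-sound fuel r m R∈)
  evens-sound (suc fuel) r (suc m) w∈ | inj₂ w∈₂
    with find (∈-concatMap⁻ (evensSplitAt fuel r m) {xs = upTo (suc r)} w∈₂)
  ... | a , a∈ , w∈₃ = evensSplitAt-sound fuel r m a (≤-pred (∈-upTo⁻ a∈)) w∈₃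

  evensSplitAt-sound : ∀ fuel r m a {w} → a ≤ r → w ∈ evensSplitAt fuel r m a → Dumont132 r (double (suc m)) w
  evensSplitAt-sound fuel r m a a≤r w∈ with ∈-evensSplitAt⁻ fuel r m a w∈
  ... | a<m , r₁ , r₁≤ , L , R , L∈ , R∈ , refl =
    subst (λ t → Dumont132 t (double (suc m)) (glue (m ∸ a) (double (suc m)) L R)) (counts-add-up a≤r r₁≤)
      (Dumont132-glue (m<n⇒0<n∸m a<m) (sym (m+[n∸m]≡n (<⇒≤ a<m)))
                      (odds-sound fuel r₁ a L∈) (evens-sound fuel _ _ R∈))
    where
    counts-add-up : ∀ {a r r₁} → a ≤ r → r₁ ≤ r ∸ a → r₁ + a + (r ∸ a ∸ r₁) ≡ r
    counts-add-up {a} {r} {r₁} a≤r r₁≤ = begin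
      r₁ + a + (r ∸ a ∸ r₁)   ≡⟨ cong (_+ (r ∸ a ∸ r₁)) (+-comm r₁ a) ⟩
      a + r₁ + (r ∸ a ∸ r₁)   ≡⟨ +-assoc a r₁ _ ⟩
      a + (r₁ + (r ∸ a ∸ r₁)) ≡⟨ cong (_+_ a) (m+[n∸m]≡n r₁≤) ⟩
      a + (r ∸ a)             ≡⟨ m+[n∸m]≡n a≤r ⟩
      r                       ∎
      where open ≡-Reasoning

  odds-sound : ∀ fuel r m {w} → w ∈ odds fuel r m → Dumont132 r (suc (double m)) w
  odds-sound (suc fuel) r m w∈ with (m ∸ 1) <ᵇ suc r in small
  ... | true with ∈-map⁻ (_++ suc (double m) ∷ []) w∈
  ... | X , X∈ , refl = subst (λ t → Dumont132 t (suc (double m)) (X ++ suc (double m) ∷ []))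
                          (m∸n+n≡m (≤-pred (<ᵇ-true⁻ {m ∸ 1} small))) (Dumont132-append-max (evens-sound fuel _ m X∈))

append-max-∈-odds : ∀ fuel {r o m X} → o + (m ∸ 1) ≡ r → X ∈ evens fuel o m →
                    X ++ suc (double m) ∷ [] ∈ odds (suc fuel) r m
append-max-∈-odds fuel {o = o} {m} refl X∈
  rewrite <ᵇ-true {m ∸ 1} {suc (o + (m ∸ 1))} (s≤s (m≤n+m (m ∸ 1) o)) | m+n∸n≡m o (m ∸ 1) = ∈-map⁺ _ X∈

mutual
  evens-complete : ∀ fuel r m {w} → double m ≤ fuel → Dumont132 r (double m) w → w ∈ evens fuel r m
  evens-complete fuel       r zero    {[]}    _ (dumont132 _        _ _ refl) = here refl
  evens-complete fuel       r zero    {_ ∷ _} _ (dumont132 (() , _) _ _ _)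
  evens-complete (suc fuel) r (suc m)         (s≤s fuel≥) D with split-at-max D
  ... | X , R , refl , s = maxSplit-∈-evens fuel m X R fuel≥ s

  maxSplit-∈-evens : ∀ fuel {r} m X R → suc (double m) ≤ fuel → MaxSplit r (suc (double m)) X R →
                     X ++ double (suc m) ∷ R ∈ evens (suc fuel) r (suc m)
  maxSplit-∈-evens fuel m X [] _ s =
    ⊥-elim (true≢false (trans (sym (MaxSplit.dumontMaxR s)) (cong not (isEven-double (suc m)))))
  maxSplit-∈-evens fuel m [] (c ∷ R) fuel≥ s =
    ∈-++⁺ˡ (∈-map⁺ _ (odds-complete fuel _ m fuel≥
      (dumont132 (lengths , subst (λ n → All (InRange n) (c ∷ R)) lengths (proj₁ (proj₂ lowerPerm)) ,
                  proj₂ (proj₂ lowerPerm))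
                 (dumont-tail (double (suc m)) (c ∷ R) dumontMaxR) avoidsR occurrences)))
    where open MaxSplit s
  maxSplit-∈-evens fuel {r} m (x ∷ X) (c ∷ R) fuel≥ s =
    ∈-++⁺ʳ (map (double (suc m) ∷_) (odds fuel r m))
      (subst (λ Y → Y ++ double (suc m) ∷ c ∷ R ∈ concatMap (evensSplitAt fuel r m) (upTo (suc r))) raised
               (glue-∈-evensSplits fuel sizes counts fuel≥ left right))
    where open Unglued (unglue s)

  glue-∈-evensSplits : ∀ fuel {r m r₁ r₂ a j L R} →
                       m ≡ a + suc j → r ≡ r₁ + a + r₂ → suc (double m) ≤ fuel →
                       Dumont132 r₁ (suc (double a)) L → Dumont132 r₂ (double (suc j)) R →
                       glue (suc j) (double (suc m)) L R ∈ concatMap (evensSplitAt fuel r m) (upTo (suc r))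
  glue-∈-evensSplits fuel {r₁ = r₁} {r₂} {a} {j} {L} {R} refl refl fuel≥ DL DR =
    ∈-concatMap-at (evensSplitAt fuel r m) (∈-upTo⁺ (s≤s a≤r)) at-a
    where
    r = r₁ + a + r₂
    m = a + suc j
    N = double (suc m)
    a≤r : a ≤ r
    a≤r = ≤-trans (m≤n+m a r₁) (m≤m+n (r₁ + a) r₂)
    r∸a≡ : r ∸ a ≡ r₁ + r₂
    r∸a≡ = trans (cong (_∸ a) (trans (cong (_+ r₂) (+-comm r₁ a)) (+-assoc a r₁ r₂))) (m+n∸m≡n a (r₁ + r₂))
    in-product : glue (suc j) N L R ∈
                 cartesianProductWith (glue (m ∸ a) N) (odds fuel r₁ a) (evens fuel (r ∸ a ∸ r₁) (m ∸ a))
    in-product rewrite m+n∸m≡n a (suc j) | r∸a≡ | m+n∸m≡n r₁ r₂ =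
      ∈-cartesianProductWith⁺ (glue (suc j) N)
        (odds-complete fuel r₁ a (≤-trans (s≤s (double-mono-≤ (m≤m+n a (suc j)))) fuel≥) DL)
        (evens-complete fuel r₂ (suc j) (≤-trans (double-mono-≤ (m≤n+m (suc j) a)) fuel≥′) DR)
      where
      fuel≥′ : double m ≤ fuel
      fuel≥′ = ≤-trans (n≤1+n (double m)) fuel≥
    at-a : glue (suc j) N L R ∈ (if a <ᵇ m then concatMap (evensSplitWith fuel r m a) (upTo (suc (r ∸ a))) else [])
    at-a rewrite <ᵇ-true (m<m+n a (z<s {j})) =
      ∈-concatMap-at (evensSplitWith fuel r m a) (∈-upTo⁺ (s≤s (subst (r₁ ≤_) (sym r∸a≡) (m≤m+n r₁ r₂))))
        in-product

  odds-complete : ∀ fuel r m {w} → suc (double m) ≤ fuel → Dumont132 r (suc (double m)) w → w ∈ odds fuel r m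
  odds-complete (suc fuel) r m (s≤s fuel≥) D with split-at-max D
  ... | X , c ∷ R , refl , s = ⊥-elim (true≢false (trans (sym (∧-trueˡ (MaxSplit.dumontMaxR s))) odd-step))
    where
    odd-step : dumontStep (suc (double m)) c ≡ false
    odd-step rewrite isEven-suc-double m = <ᵇ-false (<⇒≤ (All.head (MaxSplit.R<max s)))
  ... | X , [] , refl , s = append-max-∈-odds fuel counts (evens-complete fuel (occ12-3 X) m fuel≥ DX)
    where
    open MaxSplit s
    permX : Perm (double m) X
    permX = trans (sym (+-identityʳ _)) lengths , All.map (λ (0<x , x≤) → 0<x , x≤) upperRange , upperUnique
    DX : Dumont132 (occ12-3 X) (double m) X
    DX = dumont132 permX dumontX avoidsX refl
    counts : occ12-3 X + (m ∸ 1) ≡ r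
    counts = trans (cong (_+_ (occ12-3 X)) (sym (ascents-dumont-even m X permX dumontX))) (trans (sym (+-identityʳ _)) occurrences)

Unique-split-at : ∀ {N : ℕ} X X' {R R'} → Unique (X ++ N ∷ R) → X ++ N ∷ R ≡ X' ++ N ∷ R' → X ≡ X' × R ≡ R'
Unique-split-at []      []         _          e = refl , ∷-injectiveʳ e
Unique-split-at {N} [] (x' ∷ X') (N∉R ∷ _) e =
  ⊥-elim (All.lookup N∉R (subst (N ∈_) (sym (∷-injectiveʳ e)) (∈-++⁺ʳ X' (here refl))) refl)
Unique-split-at (x ∷ X) []         (x∉ ∷ _)   e = ⊥-elim (All.lookup x∉ (∈-++⁺ʳ X (here refl)) (∷-injectiveˡ e))
Unique-split-at (x ∷ X) (x' ∷ X') (_ ∷ u)    e with ∷-injective e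
... | refl , e′ with Unique-split-at X X' u e′
...   | refl , R≡R' = refl , R≡R'

odds-length : ∀ fuel r m {L} → L ∈ odds fuel r m → length L ≡ suc (double m)
odds-length fuel r m L∈ = proj₁ (Dumont132.perm (odds-sound fuel r m L∈))

glue-injective : ∀ {j N L L' R R'} → length L ≡ length L' → glue j N L R ≡ glue j N L' R' → L ≡ L' × R ≡ R'
glue-injective {j} {N} {L} {L'} len e
  with ++-cancel-length (raise (double j) L) (raise (double j) L') e
         (trans (length-map _ L) (trans len (sym (length-map _ L'))))
... | raised , rest = map-injective (+-cancelˡ-≡ (double j) _ _) raised , ∷-injectiveʳ rest

-- Summands for different a or r₁ are told apart by the length of the part before the
-- maximum and by the occurrences of 12-3 in it.
evensSplitAt-index : ∀ fuel r m {a b w} → a ≤ r →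
                     w ∈ evensSplitAt fuel r m a → w ∈ evensSplitAt fuel r m b → a ≡ b
evensSplitAt-index fuel r m {a} {b} a≤r w∈ w∈′
  with ∈-evensSplitAt⁻ fuel r m a w∈ | ∈-evensSplitAt⁻ fuel r m b w∈′
... | _ , r₁ , _ , L , R , L∈ , _ , refl | _ , r₁′ , _ , L′ , R′ , L′∈ , _ , e
  with Unique-split-at (raise _ L) (raise _ L′) (proj₂ (proj₂ (Dumont132.perm (evensSplitAt-sound fuel r m a a≤r w∈)))) e
...   | raised , _ = double-injective (suc-injective
          (trans (sym (odds-length fuel r₁ a L∈))
          (trans (sym (length-map _ L)) (trans (cong length raised)
          (trans (length-map _ L′) (odds-length fuel r₁′ b L′∈))))))

evensSplitWith-index : ∀ fuel r m a {r₁ r₁′ w} →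
                       w ∈ evensSplitWith fuel r m a r₁ → w ∈ evensSplitWith fuel r m a r₁′ → r₁ ≡ r₁′
evensSplitWith-index fuel r m a {r₁} {r₁′} w∈ w∈′
  with ∈-cartesianProductWith⁻ (glue (m ∸ a) (double (suc m))) (odds fuel r₁ a) _ w∈
     | ∈-cartesianProductWith⁻ (glue (m ∸ a) (double (suc m))) (odds fuel r₁′ a) _ w∈′
... | L , R , L∈ , _ , refl | L′ , R′ , L′∈ , _ , e
  with glue-injective (trans (odds-length fuel r₁ a L∈) (sym (odds-length fuel r₁′ a L′∈))) e
...   | refl , _ = trans (sym (Dumont132.occurrences (odds-sound fuel r₁ a L∈)))
                         (Dumont132.occurrences (odds-sound fuel r₁′ a L′∈))

mutual
  evens-unique : ∀ fuel r m → Unique (evens fuel r m)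
  evens-unique fuel       zero    zero    = [] ∷ []
  evens-unique fuel       (suc r) zero    = []
  evens-unique zero       r       (suc m) = []
  evens-unique (suc fuel) r       (suc m) =
    Unique.++⁺ (Unique.map⁺ ∷-injectiveʳ (odds-unique fuel r m))
      (Unique-concatMap (evensSplitAt fuel r m) (Unique.upTo⁺ (suc r)) (λ {a} _ → evensSplitAt-unique fuel r m a)
        (λ a∈ _ a≢b (w∈ , w∈′) → a≢b (evensSplitAt-index fuel r m (≤-pred (∈-upTo⁻ a∈)) w∈ w∈′)))
      max-first-disjoint
    where
    max-first-disjoint : Disjoint (map (double (suc m) ∷_) (odds fuel r m)) (concatMap (evensSplitAt fuel r m) (upTo (suc r)))
    max-first-disjoint (w∈₁ , w∈₂)
      with ∈-map⁻ (double (suc m) ∷_) w∈₁ | find (∈-concatMap⁻ (evensSplitAt fuel r m) {xs = upTo (suc r)} w∈₂)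
    ... | R , R∈ , refl | a , _ , w∈ with ∈-evensSplitAt⁻ fuel r m a w∈
    ...   | _ , r₁ , _ , L , _ , L∈ , _ , e =
      0≢1+n (trans (cong length (proj₁ (Unique-split-at [] (raise _ L) unique e)))
                   (trans (length-map _ L) (odds-length fuel r₁ a L∈)))
      where
      unique = proj₂ (proj₂ (Dumont132.perm (Dumont132-prepend-max (odds-sound fuel r m R∈))))

  evensSplitAt-unique : ∀ fuel r m a → Unique (evensSplitAt fuel r m a)
  evensSplitAt-unique fuel r m a with a <ᵇ m
  ... | false = []
  ... | true  = Unique-concatMap (evensSplitWith fuel r m a) (Unique.upTo⁺ (suc (r ∸ a)))
                  (λ {r₁} _ → evensSplitWith-unique fuel r m a r₁)
                  (λ _ _ r₁≢r₁′ (w∈ , w∈′) → r₁≢r₁′ (evensSplitWith-index fuel r m a w∈ w∈′))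

  evensSplitWith-unique : ∀ fuel r m a r₁ → Unique (evensSplitWith fuel r m a r₁)
  evensSplitWith-unique fuel r m a r₁ =
    Unique-cartesianProductWith-on (glue (m ∸ a) (double (suc m)))
      (λ L∈ L′∈ _ _ → glue-injective (trans (odds-length fuel r₁ a L∈) (sym (odds-length fuel r₁ a L′∈))))
      (odds-unique fuel r₁ a) (evens-unique fuel (r ∸ a ∸ r₁) (m ∸ a))

  odds-unique : ∀ fuel r m → Unique (odds fuel r m)
  odds-unique zero       r m = []
  odds-unique (suc fuel) r m with (m ∸ 1) <ᵇ suc r
  ... | false = []
  ... | true  = Unique.map⁺ (λ {X} {X′} → ++-cancelʳ (suc (double m) ∷ []) X X′) (evens-unique fuel (r ∸ (m ∸ 1)) m)

-- Counting

isDumont132 : ℕ → ℕ → List ℕ → Bool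
isDumont132 r n w = isPerm n w ∧ dumont w ∧ not (contains132 w) ∧ (occ12-3 w ≡ᵇ r)

isDumont132⇒Dumont132 : ∀ r n w → isDumont132 r n w ≡ true → Dumont132 r n w
isDumont132⇒Dumont132 r n w e =
  dumont132 (isPerm⇒Perm n w (∧-trueˡ e)) (∧-trueˡ rest)
            (not-injective (∧-trueˡ rest′)) (≡ᵇ-true⁻ (∧-trueʳ rest′))
  where
  rest  = ∧-trueʳ {isPerm n w} e
  rest′ = ∧-trueʳ {dumont w} rest

Dumont132⇒isDumont132 : ∀ {r n w} → Dumont132 r n w → isDumont132 r n w ≡ true
Dumont132⇒isDumont132 {r} {n} {w} (dumont132 p d avoid occ) =
  ∧-true {isPerm n w} (Perm⇒isPerm n w p) (∧-true d (∧-true (cong not avoid) (≡ᵇ-true occ)))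

D-count : ∀ r n (ws : List (List ℕ)) → Unique ws →
          (∀ {w} → Dumont132 r n w → w ∈ ws) → (∀ {w} → w ∈ ws → Dumont132 r n w) → D r n ≡ length ws
D-count r n ws unique complete sound =
  Unique-length (Unique.filter⁺ holds (Unique-words n (Unique.map⁺ suc-injective (Unique.upTo⁺ n)))) unique
    (λ w∈ → complete (isDumont132⇒Dumont132 r n _ (T⇒≡true (proj₂ (∈-filter⁻ holds {xs = candidates} w∈)))))
    (λ w∈ → ∈-filter⁺ holds (candidate (sound w∈)) (≡true⇒T (Dumont132⇒isDumont132 (sound w∈))))
  where
  holds = λ w → T? (isDumont132 r n w)
  candidates = words n (map suc (upTo n))
  candidate : ∀ {w} → Dumont132 r n w → w ∈ candidates
  candidate {w} (dumont132 (len , range , _) _ _ _) =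
    ∈-words⁺ n w len (All.map (λ { {suc a} (_ , s≤s a<n) → ∈-map⁺ suc (∈-upTo⁺ (s≤s a<n)) }) range)

Deven Dodd : ℕ → ℕ → ℕ
Deven r m = D r (double m)
Dodd  r m = D r (suc (double m))

Deven≡length-evens : ∀ fuel r m → double m ≤ fuel → Deven r m ≡ length (evens fuel r m)
Deven≡length-evens fuel r m fuel≥ =
  D-count r (double m) _ (evens-unique fuel r m) (evens-complete fuel r m fuel≥) (evens-sound fuel r m)

Dodd≡length-odds : ∀ fuel r m → suc (double m) ≤ fuel → Dodd r m ≡ length (odds fuel r m)
Dodd≡length-odds fuel r m fuel≥ =
  D-count r (suc (double m)) _ (odds-unique fuel r m) (odds-complete fuel r m fuel≥) (odds-sound fuel r m)

splitSum : (ℕ → ℕ → ℕ) → (ℕ → ℕ → ℕ) → ℕ → ℕ → ℕ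
splitSum odd even r m =
  sumMap (λ a → if a <ᵇ m then sumMap (λ r₁ → odd r₁ a * even (r ∸ a ∸ r₁) (m ∸ a)) (upTo (suc (r ∸ a))) else 0)
         (upTo (suc r))

Deven-zero : ∀ r → Deven r 0 ≡ (if r ≡ᵇ 0 then 1 else 0)
Deven-zero zero    = Deven≡length-evens 0 0 0 z≤n
Deven-zero (suc r) = Deven≡length-evens 0 (suc r) 0 z≤n

Dodd-recurrence : ∀ r m → Dodd r m ≡ (if (m ∸ 1) <ᵇ suc r then Deven (r ∸ (m ∸ 1)) m else 0)
Dodd-recurrence r m = trans (Dodd≡length-odds (suc (double m)) r m ≤-refl) count
  where
  count : length (odds (suc (double m)) r m) ≡ (if (m ∸ 1) <ᵇ suc r then Deven (r ∸ (m ∸ 1)) m else 0)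
  count with (m ∸ 1) <ᵇ suc r
  ... | false = refl
  ... | true  = trans (length-map _ (evens (double m) (r ∸ (m ∸ 1)) m))
                      (sym (Deven≡length-evens (double m) (r ∸ (m ∸ 1)) m ≤-refl))

Deven-recurrence : ∀ r m → Deven r (suc m) ≡ Dodd r m + splitSum Dodd Deven r m
Deven-recurrence r m = begin
  Deven r (suc m)
    ≡⟨ Deven≡length-evens (suc fuel) r (suc m) ≤-refl ⟩
  length (map (double (suc m) ∷_) (odds fuel r m) ++ concatMap (evensSplitAt fuel r m) (upTo (suc r)))
    ≡⟨ length-++ (map (double (suc m) ∷_) (odds fuel r m)) ⟩
  length (map (double (suc m) ∷_) (odds fuel r m)) + length (concatMap (evensSplitAt fuel r m) (upTo (suc r)))
    ≡⟨ cong₂ _+_ (trans (length-map _ (odds fuel r m)) (sym (Dodd≡length-odds fuel r m ≤-refl)))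
                 (trans (length-concatMap (evensSplitAt fuel r m) (upTo (suc r)))
                        (sumMap-cong (upTo (suc r)) (λ a _ → split-count a))) ⟩
  Dodd r m + splitSum Dodd Deven r m ∎
  where
  open ≡-Reasoning
  fuel = suc (double m)
  split-count : ∀ a → length (evensSplitAt fuel r m a)
                    ≡ (if a <ᵇ m then sumMap (λ r₁ → Dodd r₁ a * Deven (r ∸ a ∸ r₁) (m ∸ a)) (upTo (suc (r ∸ a))) else 0)
  split-count a with a <ᵇ m in a<ᵇm
  ... | false = refl
  ... | true  = trans (length-concatMap (evensSplitWith fuel r m a) (upTo (suc (r ∸ a))))
                  (sumMap-cong (upTo (suc (r ∸ a))) (λ r₁ _ →
                    trans (length-cartesianProductWith _ (odds fuel r₁ a) (evens fuel (r ∸ a ∸ r₁) (m ∸ a)))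
                      (sym (cong₂ _*_ (Dodd≡length-odds fuel r₁ a (s≤s (double-mono-≤ (<⇒≤ (<ᵇ-true⁻ a<ᵇm)))))
                                      (Deven≡length-evens fuel (r ∸ a ∸ r₁) (m ∸ a)
                                         (≤-trans (double-mono-≤ (m∸n≤m m a)) (n≤1+n (double m))))))))

-- Solving the recurrence for r ≤ 4

all-agree⇒≡ : ∀ {A : Set} (_≟ᴬ_ : DecidableEquality A) (f g : ℕ → A) B →
              all (λ n → does (f n ≟ᴬ g n)) (upTo B) ≡ true → ∀ n → n < B → f n ≡ g n
all-agree⇒≡ _≟ᴬ_ f g B agree n n<B = agree-at (All.lookup (all-true⁻ (upTo B) agree) (∈-upTo⁺ n<B))
  where
  agree-at : does (f n ≟ᴬ g n) ≡ true → f n ≡ g n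
  agree-at _ with f n ≟ᴬ g n
  ... | yes fn≡gn = fn≡gn

initialRow : ℕ → List ℕ
initialRow 0 = 1 ∷ 1 ∷ 2 ∷ 2 ∷ 2 ∷ 2 ∷ 2  ∷ []
initialRow 1 = 0 ∷ 0 ∷ 0 ∷ 3 ∷ 5 ∷ 7 ∷ 9  ∷ []
initialRow 2 = 0 ∷ 0 ∷ 0 ∷ 0 ∷ 2 ∷ 5 ∷ 10 ∷ []
initialRow 3 = 0 ∷ 0 ∷ 0 ∷ 0 ∷ 5 ∷ 11 ∷ 17 ∷ []
initialRow 4 = 0 ∷ 0 ∷ 0 ∷ 0 ∷ 0 ∷ 5 ∷ 18 ∷ []
initialRow _ = []

entry : List ℕ → ℕ → ℕ
entry []       _       = 0
entry (x ∷ xs) zero    = x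
entry (x ∷ xs) (suc m) = entry xs m

-- Once m ≥ 6 only the summands a ≤ 2 of splitSum survive, and the recurrence becomes
-- Deven r (m+1) = Deven r m + Deven (r-1) (m-1) + 2 Deven (r-3) (m-2).
mutual
  evenTable : ℕ → ℕ → ℕ
  evenTable r (suc m@(suc m′@(suc m″@(suc (suc (suc (suc _))))))) =
    evenTable r m + lowerTable 1 r m′ + 2 * lowerTable 3 r m″
  evenTable r m = entry (initialRow r) m

  lowerTable : ℕ → ℕ → ℕ → ℕ
  lowerTable k r m = if k ≤ᵇ r then evenTable (r ∸ k) m else 0

oddTable : ℕ → ℕ → ℕ
oddTable r m = if (m ∸ 1) <ᵇ suc r then evenTable (r ∸ (m ∸ 1)) m else 0

tables-recurrence : ∀ r → r ≤ 4 → ∀ m → evenTable r (suc m) ≡ oddTable r m + splitSum oddTable evenTable r m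
tables-recurrence r r≤4 m with m <? 6
... | yes m<6 = all-agree⇒≡ _≟_ (λ m → evenTable r (suc m)) (λ m → oddTable r m + splitSum oddTable evenTable r m)
                  6 (initial r r≤4) m m<6
  where
  initial : ∀ r → r ≤ 4 →
            all (λ m → does (evenTable r (suc m) ≟ oddTable r m + splitSum oddTable evenTable r m)) (upTo 6) ≡ true
  initial 0 _ = refl
  initial 1 _ = refl
  initial 2 _ = refl
  initial 3 _ = refl
  initial 4 _ = refl
  initial (suc (suc (suc (suc (suc _))))) (s≤s (s≤s (s≤s (s≤s ()))))
... | no m≮6 with ≤⇒≡+ (≮⇒≥ m≮6)
...   | k , refl = large r r≤4
  where
  normal-form : ∀ x y z → x + y + 2 * z ≡ x + 0 + 0 + (y + 0 + 0 + (z + (z + 0) + 0 + 0))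
  normal-form = solve-∀
  large : ∀ r → r ≤ 4 → evenTable r (7 + k) ≡ oddTable r (6 + k) + splitSum oddTable evenTable r (6 + k)
  large 0 _ = normal-form (evenTable 0 (6 + k)) (lowerTable 1 0 (5 + k)) (lowerTable 3 0 (4 + k))
  large 1 _ = normal-form (evenTable 1 (6 + k)) (lowerTable 1 1 (5 + k)) (lowerTable 3 1 (4 + k))
  large 2 _ = normal-form (evenTable 2 (6 + k)) (lowerTable 1 2 (5 + k)) (lowerTable 3 2 (4 + k))
  large 3 _ = normal-form (evenTable 3 (6 + k)) (lowerTable 1 3 (5 + k)) (lowerTable 3 3 (4 + k))
  large 4 _ = normal-form (evenTable 4 (6 + k)) (lowerTable 1 4 (5 + k)) (lowerTable 3 4 (4 + k))
  large (suc (suc (suc (suc (suc _))))) (s≤s (s≤s (s≤s (s≤s ()))))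

splitSum-cong : ∀ {odd odd′ even even′ : ℕ → ℕ → ℕ} r m →
                (∀ r₁ a → r₁ ≤ r → a < m → odd r₁ a ≡ odd′ r₁ a) →
                (∀ r′ m′ → r′ ≤ r → m′ ≤ m → even r′ m′ ≡ even′ r′ m′) →
                splitSum odd even r m ≡ splitSum odd′ even′ r m
splitSum-cong {odd} {odd′} {even} {even′} r m odd≡ even≡ =
  sumMap-cong (upTo (suc r)) (λ a a∈ → summand a (≤-pred (∈-upTo⁻ a∈)))
  where
  summand : ∀ a → a ≤ r →
            (if a <ᵇ m then sumMap (λ r₁ → odd r₁ a * even (r ∸ a ∸ r₁) (m ∸ a)) (upTo (suc (r ∸ a))) else 0) ≡
            (if a <ᵇ m then sumMap (λ r₁ → odd′ r₁ a * even′ (r ∸ a ∸ r₁) (m ∸ a)) (upTo (suc (r ∸ a))) else 0)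
  summand a a≤r with a <ᵇ m in a<ᵇm
  ... | false = refl
  ... | true  = sumMap-cong (upTo (suc (r ∸ a))) (λ r₁ r₁∈ →
                  cong₂ _*_ (odd≡ r₁ a (≤-trans (≤-pred (∈-upTo⁻ r₁∈)) (m∸n≤m r a)) (<ᵇ-true⁻ a<ᵇm))
                            (even≡ _ _ (≤-trans (m∸n≤m (r ∸ a) r₁) (m∸n≤m r a)) (m∸n≤m m a)))

Dodd≡oddTable : ∀ {m} → (∀ r → r ≤ 4 → Deven r m ≡ evenTable r m) → ∀ r → r ≤ 4 → Dodd r m ≡ oddTable r m
Dodd≡oddTable {m} Deven≡ r r≤4 = trans (Dodd-recurrence r m) agree
  where
  agree : (if (m ∸ 1) <ᵇ suc r then Deven (r ∸ (m ∸ 1)) m else 0) ≡ oddTable r m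
  agree with (m ∸ 1) <ᵇ suc r
  ... | true  = Deven≡ (r ∸ (m ∸ 1)) (≤-trans (m∸n≤m r (m ∸ 1)) r≤4)
  ... | false = refl

Deven≡evenTable : ∀ m r → r ≤ 4 → Deven r m ≡ evenTable r m
Deven≡evenTable = <-rec _ step
  where
  step : ∀ m → (∀ {m′} → m′ < m → ∀ r → r ≤ 4 → Deven r m′ ≡ evenTable r m′) →
         ∀ r → r ≤ 4 → Deven r m ≡ evenTable r m
  step zero    _  r r≤4 = trans (Deven-zero r) (initial r r≤4)
    where
    initial : ∀ r → r ≤ 4 → (if r ≡ᵇ 0 then 1 else 0) ≡ evenTable r 0
    initial 0 _ = refl
    initial 1 _ = refl
    initial 2 _ = refl
    initial 3 _ = refl
    initial 4 _ = refl
    initial (suc (suc (suc (suc (suc _))))) (s≤s (s≤s (s≤s (s≤s ()))))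
  step (suc m) ih r r≤4 = begin
    Deven r (suc m)                                  ≡⟨ Deven-recurrence r m ⟩
    Dodd r m + splitSum Dodd Deven r m               ≡⟨ cong₂ _+_ (Dodd≡oddTable {m} (ih ≤-refl) r r≤4)
                                                                  (splitSum-cong r m odd≡ even≡) ⟩
    oddTable r m + splitSum oddTable evenTable r m   ≡⟨ tables-recurrence r r≤4 m ⟨
    evenTable r (suc m)                              ∎
    where
    open ≡-Reasoning
    odd≡ : ∀ r₁ a → r₁ ≤ r → a < m → Dodd r₁ a ≡ oddTable r₁ a
    odd≡ r₁ a r₁≤r a<m = Dodd≡oddTable {a} (ih (m<n⇒m<1+n a<m)) r₁ (≤-trans r₁≤r r≤4)
    even≡ : ∀ r′ m′ → r′ ≤ r → m′ ≤ m → Deven r′ m′ ≡ evenTable r′ m′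
    even≡ r′ m′ r′≤r m′≤m = ih (s≤s m′≤m) r′ (≤-trans r′≤r r≤4)

-- Generating functions

EventuallyZero : ℕ → Series → Set
EventuallyZero N f = ∀ n → N ≤ n → f n ≡ + 0

mul1-x²-cong : ∀ {f g : Series} → (∀ i → f i ≡ g i) → ∀ n → mul1-x² f n ≡ mul1-x² g n
mul1-x²-cong f≡g zero          = f≡g 0
mul1-x²-cong f≡g (suc zero)    = f≡g 1
mul1-x²-cong f≡g (suc (suc n)) = cong₂ ℤ._-_ (f≡g (suc (suc n))) (f≡g n)

mul1-x²^-cong : ∀ {f g : Series} → (∀ i → f i ≡ g i) → ∀ k n → mul1-x²^ k f n ≡ mul1-x²^ k g n
mul1-x²^-cong f≡g zero    n = f≡g n
mul1-x²^-cong f≡g (suc k) n = mul1-x²-cong (mul1-x²^-cong f≡g k) n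

mul1-x²^-cong-from : ∀ {f g : Series} k N → (∀ i → N ≤ i → f i ≡ g i) →
                     ∀ n → double k + N ≤ n → mul1-x²^ k f n ≡ mul1-x²^ k g n
mul1-x²^-cong-from zero    N f≡g n             N≤n             = f≡g n N≤n
mul1-x²^-cong-from (suc k) N f≡g (suc (suc n)) (s≤s (s≤s k+N≤n)) =
  cong₂ ℤ._-_ (mul1-x²^-cong-from k N f≡g (suc (suc n)) (m≤n⇒m≤1+n (m≤n⇒m≤1+n k+N≤n)))
              (mul1-x²^-cong-from k N f≡g n k+N≤n)

mul1-x²^-zero : ∀ k n → mul1-x²^ k (λ _ → + 0) n ≡ + 0
mul1-x²^-zero zero    n             = refl
mul1-x²^-zero (suc k) zero          = mul1-x²^-zero k 0
mul1-x²^-zero (suc k) (suc zero)    = mul1-x²^-zero k 1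
mul1-x²^-zero (suc k) (suc (suc n)) = cong₂ ℤ._-_ (mul1-x²^-zero k (suc (suc n))) (mul1-x²^-zero k n)

mul1-x²^-suc : ∀ k (f : Series) n → mul1-x²^ k (mul1-x² f) n ≡ mul1-x²^ (suc k) f n
mul1-x²^-suc zero    f n = refl
mul1-x²^-suc (suc k) f n = mul1-x²-cong (mul1-x²^-suc k f) n

mul1-x²^-+ : ∀ k (f g : Series) n → mul1-x²^ k (λ i → f i ℤ.+ g i) n ≡ mul1-x²^ k f n ℤ.+ mul1-x²^ k g n
mul1-x²^-+ zero    f g n             = refl
mul1-x²^-+ (suc k) f g zero          = mul1-x²^-+ k f g 0
mul1-x²^-+ (suc k) f g (suc zero)    = mul1-x²^-+ k f g 1
mul1-x²^-+ (suc k) f g (suc (suc n))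
  rewrite mul1-x²^-+ k f g (suc (suc n)) | mul1-x²^-+ k f g n =
  interchange (mul1-x²^ k f (suc (suc n))) (mul1-x²^ k g (suc (suc n))) (mul1-x²^ k f n) (mul1-x²^ k g n)
  where
  interchange : ∀ a b c d → (a ℤ.+ b) ℤ.- (c ℤ.+ d) ≡ (a ℤ.- c) ℤ.+ (b ℤ.- d)
  interchange = ℤ-Solver.solve-∀

mul1-x²^-scale : ∀ k c (f : Series) n → mul1-x²^ k (λ i → c ℤ.* f i) n ≡ c ℤ.* mul1-x²^ k f n
mul1-x²^-scale zero    c f n             = refl
mul1-x²^-scale (suc k) c f zero          = mul1-x²^-scale k c f 0
mul1-x²^-scale (suc k) c f (suc zero)    = mul1-x²^-scale k c f 1
mul1-x²^-scale (suc k) c f (suc (suc n))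
  rewrite mul1-x²^-scale k c f (suc (suc n)) | mul1-x²^-scale k c f n =
  factor c (mul1-x²^ k f (suc (suc n))) (mul1-x²^ k f n)
  where
  factor : ∀ c a b → c ℤ.* a ℤ.- c ℤ.* b ≡ c ℤ.* (a ℤ.- b)
  factor = ℤ-Solver.solve-∀

shift-≥ : ∀ s (f : Series) n → s ≤ n → shift s f n ≡ f (n ∸ s)
shift-≥ zero    f n       _       = refl
shift-≥ (suc s) f (suc n) (s≤s s≤n) = shift-≥ s f n s≤n

mul1-x²^-shift : ∀ s k (f : Series) n → double k + s ≤ n → mul1-x²^ k (shift s f) n ≡ mul1-x²^ k f (n ∸ s)
mul1-x²^-shift s zero    f n             s≤n                 = shift-≥ s f n s≤n
mul1-x²^-shift s (suc k) f (suc (suc n)) (s≤s (s≤s k+s≤n))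
  rewrite +-∸-assoc 2 (≤-trans (m≤n+m s (double k)) k+s≤n) =
  cong₂ ℤ._-_ (trans (mul1-x²^-shift s k f (suc (suc n)) (m≤n⇒m≤1+n (m≤n⇒m≤1+n k+s≤n)))
                     (cong (mul1-x²^ k f) (+-∸-assoc 2 (≤-trans (m≤n+m s (double k)) k+s≤n))))
              (mul1-x²^-shift s k f n k+s≤n)

mul1-x²^-+-exponent : ∀ j k (f : Series) n → mul1-x²^ (j + k) f n ≡ mul1-x²^ j (mul1-x²^ k f) n
mul1-x²^-+-exponent zero    k f n = refl
mul1-x²^-+-exponent (suc j) k f n = mul1-x²-cong (mul1-x²^-+-exponent j k f) n

EventuallyZero-mono : ∀ {N N′ f} → N ≤ N′ → EventuallyZero N f → EventuallyZero N′ f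
EventuallyZero-mono N≤N′ f≡0 n N′≤n = f≡0 n (≤-trans N≤N′ N′≤n)

EventuallyZero-mul1-x²^ : ∀ {N f} j k → EventuallyZero N (mul1-x²^ k f) → EventuallyZero (double j + N) (mul1-x²^ (j + k) f)
EventuallyZero-mul1-x²^ {N} {f} j k f≡0 n j+N≤n =
  trans (mul1-x²^-+-exponent j k f n)
        (trans (mul1-x²^-cong-from j N f≡0 n j+N≤n) (mul1-x²^-zero j n))

EventuallyZero-shift : ∀ {N k f} s → double k ≤ N → EventuallyZero N (mul1-x²^ k f) →
                       EventuallyZero (s + N) (mul1-x²^ k (shift s f))
EventuallyZero-shift {N} {k} {f} s k≤N f≡0 n s+N≤n =
  trans (mul1-x²^-shift s k f n (≤-trans (subst (_≤ s + N) (+-comm s (double k)) (+-monoʳ-≤ s k≤N)) s+N≤n))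
        (f≡0 (n ∸ s) (subst (_≤ n ∸ s) (m+n∸m≡n s N) (∸-monoˡ-≤ s s+N≤n)))

EventuallyZero-+ : ∀ {N k f g} c → EventuallyZero N (mul1-x²^ k f) → EventuallyZero N (mul1-x²^ k g) →
                   EventuallyZero N (mul1-x²^ k (λ i → f i ℤ.+ c ℤ.* g i))
EventuallyZero-+ {k = k} {f} {g} c f≡0 g≡0 n N≤n
  rewrite mul1-x²^-+ k f (λ i → c ℤ.* g i) n | mul1-x²^-scale k c g n | f≡0 n N≤n | g≡0 n N≤n =
  cong (λ t → + 0 ℤ.+ t) (ℤ.*-zeroʳ c)

interleave : (ℕ → ℕ) → (ℕ → ℕ) → ℕ → ℕ
interleave e o zero          = e 0
interleave e o (suc zero)    = o 0
interleave e o (suc (suc n)) = interleave (λ m → e (suc m)) (λ m → o (suc m)) n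

interleave-double : ∀ e o m → interleave e o (double m) ≡ e m
interleave-double e o zero    = refl
interleave-double e o (suc m) = interleave-double (λ m → e (suc m)) (λ m → o (suc m)) m

interleave-suc-double : ∀ e o m → interleave e o (suc (double m)) ≡ o m
interleave-suc-double e o zero    = refl
interleave-suc-double e o (suc m) = interleave-suc-double (λ m → e (suc m)) (λ m → o (suc m)) m

D≡table : ∀ r → r ≤ 4 → ∀ n → D r n ≡ interleave (evenTable r) (oddTable r) n
D≡table r r≤4 n with parity n
... | inj₁ (m , refl) = trans (Deven≡evenTable m r r≤4) (sym (interleave-double _ _ m))
... | inj₂ (m , refl) =
  trans (Dodd≡oddTable {m} (λ r′ → Deven≡evenTable m r′) r r≤4) (sym (interleave-suc-double _ _ m))

tableSeries : ℕ → Series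
tableSeries r n = + interleave (evenTable r) (oddTable r) n

lowerSeries : ℕ → ℕ → Series
lowerSeries k r n = if k ≤ᵇ r then tableSeries (r ∸ k) n else + 0

oddTable-vanishes : ∀ r m → suc (suc r) ≤ m → oddTable r m ≡ 0
oddTable-vanishes r (suc m) (s≤s r<m) rewrite <ᵇ-false {m} {suc r} r<m = refl

lowerSeries-double : ∀ k r m → lowerSeries k r (double m) ≡ + lowerTable k r m
lowerSeries-double k r m with k ≤ᵇ r
... | true  = cong +_ (interleave-double (evenTable (r ∸ k)) (oddTable (r ∸ k)) m)
... | false = refl

lowerSeries-suc-double : ∀ k r m → suc (suc r) ≤ k + m → lowerSeries k r (suc (double m)) ≡ + 0
lowerSeries-suc-double k r m r+2≤k+m with k ≤ᵇ r in k≤ᵇr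
... | false = refl
... | true  = cong +_ (trans (interleave-suc-double (evenTable (r ∸ k)) (oddTable (r ∸ k)) m) (oddTable-vanishes (r ∸ k) m
                (subst (_≤ m) (+-∸-assoc 2 k≤r) (subst (2 + r ∸ k ≤_) (m+n∸m≡n k m) (∸-monoˡ-≤ k r+2≤k+m)))))
  where k≤r = ≤ᵇ⇒≤ k r (≡true⇒T k≤ᵇr)

[x+y+2z]-x≡y+2z : ∀ x y z → + (x + y + 2 * z) ℤ.- + x ≡ + y ℤ.+ + 2 ℤ.* + z
[x+y+2z]-x≡y+2z x y z =
  trans (cong (ℤ._- + x) (trans (ℤ.pos-+ (x + y) (2 * z)) (cong₂ ℤ._+_ (ℤ.pos-+ x y) (ℤ.pos-* 2 z))))
        (cancel (+ x) (+ y) (+ 2 ℤ.* + z))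
  where
  cancel : ∀ a b c → a ℤ.+ b ℤ.+ c ℤ.- a ≡ b ℤ.+ c
  cancel = ℤ-Solver.solve-∀

tableSeries-step : ∀ r → r ≤ 4 → ∀ n → 14 ≤ n →
                   mul1-x² (tableSeries r) n ≡ shift 4 (lowerSeries 1 r) n ℤ.+ + 2 ℤ.* shift 6 (lowerSeries 3 r) n
tableSeries-step r r≤4 n 14≤n with ≤⇒≡+ 14≤n
... | t′ , refl with parity t′
...   | inj₁ (t , refl) = begin
  tableSeries r (double (7 + t)) ℤ.- tableSeries r (double (6 + t))
    ≡⟨ cong₂ (λ a b → + a ℤ.- + b) (interleave-double (evenTable r) (oddTable r) (7 + t))
                                   (interleave-double (evenTable r) (oddTable r) (6 + t)) ⟩
  + (evenTable r (6 + t) + lowerTable 1 r (5 + t) + 2 * lowerTable 3 r (4 + t)) ℤ.- + evenTable r (6 + t)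
    ≡⟨ [x+y+2z]-x≡y+2z (evenTable r (6 + t)) (lowerTable 1 r (5 + t)) (lowerTable 3 r (4 + t)) ⟩
  + lowerTable 1 r (5 + t) ℤ.+ + 2 ℤ.* + lowerTable 3 r (4 + t)
    ≡⟨ cong₂ (λ a b → a ℤ.+ + 2 ℤ.* b) (lowerSeries-double 1 r (5 + t)) (lowerSeries-double 3 r (4 + t)) ⟨
  lowerSeries 1 r (double (5 + t)) ℤ.+ + 2 ℤ.* lowerSeries 3 r (double (4 + t)) ∎
  where open ≡-Reasoning
...   | inj₂ (t , refl) = begin
  tableSeries r (suc (double (7 + t))) ℤ.- tableSeries r (suc (double (6 + t)))
    ≡⟨ cong₂ (λ a b → + a ℤ.- + b)
         (trans (interleave-suc-double (evenTable r) (oddTable r) (7 + t)) (oddTable-vanishes r (7 + t) (bound (suc t))))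
         (trans (interleave-suc-double (evenTable r) (oddTable r) (6 + t)) (oddTable-vanishes r (6 + t) (bound t))) ⟩
  + 0
    ≡⟨ cong₂ (λ a b → a ℤ.+ + 2 ℤ.* b) (lowerSeries-suc-double 1 r (5 + t) (bound t))
                                       (lowerSeries-suc-double 3 r (4 + t) (bound (suc t))) ⟨
  lowerSeries 1 r (suc (double (5 + t))) ℤ.+ + 2 ℤ.* lowerSeries 3 r (suc (double (4 + t))) ∎
  where
  open ≡-Reasoning
  bound : ∀ t → suc (suc r) ≤ 6 + t
  bound t = ≤-trans (s≤s (s≤s r≤4)) (m≤m+n 6 t)

EventuallyZero-zero : ∀ N k → EventuallyZero N (mul1-x²^ k (λ _ → + 0))
EventuallyZero-zero N k n _ = mul1-x²^-zero k n

-- The inductive step for (1 - x²)^(r+1) 𝒟_r(x) being a polynomial.  The side conditions on the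
-- degree bounds are implicit arguments of type T (…), filled in by computation.
EventuallyZero-step : ∀ r {Bg Bh} {_ : T (r ≤ᵇ 4)} →
                      EventuallyZero Bg (mul1-x²^ r (lowerSeries 1 r)) → EventuallyZero Bh (mul1-x²^ r (lowerSeries 3 r)) →
                      {_ : T (double r + 10 ≤ᵇ Bg)} {_ : T (double r ≤ᵇ Bh)} {_ : T (Bh + 2 ≤ᵇ Bg)} →
                      EventuallyZero (4 + Bg) (mul1-x²^ (suc r) (tableSeries r))
EventuallyZero-step r {Bg} {Bh} {r≤4} g≡0 h≡0 {r+10≤Bg} {r≤Bh} {Bh+2≤Bg} n 4+Bg≤n = begin
  mul1-x²^ (suc r) (tableSeries r) n
    ≡⟨ mul1-x²^-suc r (tableSeries r) n ⟨
  mul1-x²^ r (mul1-x² (tableSeries r)) n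
    ≡⟨ mul1-x²^-cong-from r 14 (tableSeries-step r (≤ᵇ⇒≤ r 4 r≤4)) n
         (≤-trans (subst (_≤ Bg + 4) (+-assoc (double r) 10 4) (+-monoˡ-≤ 4 (≤ᵇ⇒≤ _ _ r+10≤Bg)))
                  (subst (_≤ n) (+-comm 4 Bg) 4+Bg≤n)) ⟩
  mul1-x²^ r (λ i → shift 4 (lowerSeries 1 r) i ℤ.+ + 2 ℤ.* shift 6 (lowerSeries 3 r) i) n
    ≡⟨ EventuallyZero-+ {k = r} {f = shift 4 (lowerSeries 1 r)} {g = shift 6 (lowerSeries 3 r)} (+ 2)
         (EventuallyZero-shift 4 r≤Bg g≡0)
         (EventuallyZero-mono (s≤s (s≤s (s≤s (s≤s Bh+2≤Bg′)))) (EventuallyZero-shift {k = r} 6 (≤ᵇ⇒≤ _ _ r≤Bh) h≡0))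
         n 4+Bg≤n ⟩
  + 0 ∎
  where
  open ≡-Reasoning
  Bh+2≤Bg′ : 2 + Bh ≤ Bg
  Bh+2≤Bg′ = subst (_≤ Bg) (+-comm Bh 2) (≤ᵇ⇒≤ _ _ Bh+2≤Bg)
  r≤Bg : double r ≤ Bg
  r≤Bg = ≤-trans (m≤m+n (double r) 10) (≤ᵇ⇒≤ _ _ r+10≤Bg)

tableSeries-tail₀ : EventuallyZero 14 (mul1-x²^ 1 (tableSeries 0))
tableSeries-tail₀ = EventuallyZero-step 0 {10} {0} (EventuallyZero-zero 10 0) (EventuallyZero-zero 0 0)

tableSeries-tail₁ : EventuallyZero 18 (mul1-x²^ 2 (tableSeries 1))
tableSeries-tail₁ = EventuallyZero-step 1 {14} {12} tableSeries-tail₀ (EventuallyZero-zero 12 1)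

tableSeries-tail₂ : EventuallyZero 22 (mul1-x²^ 3 (tableSeries 2))
tableSeries-tail₂ = EventuallyZero-step 2 {18} {16} tableSeries-tail₁ (EventuallyZero-zero 16 2)

tableSeries-tail₃ : EventuallyZero 26 (mul1-x²^ 4 (tableSeries 3))
tableSeries-tail₃ = EventuallyZero-step 3 {22} {18} tableSeries-tail₂ (EventuallyZero-mul1-x²^ 2 1 tableSeries-tail₀)

tableSeries-tail₄ : EventuallyZero 30 (mul1-x²^ 5 (tableSeries 4))
tableSeries-tail₄ = EventuallyZero-step 4 {26} {22} tableSeries-tail₃ (EventuallyZero-mul1-x²^ 2 2 tableSeries-tail₁)

poly-vanishes : ∀ s cs B → s + length cs ≤ B → EventuallyZero B (shift s (poly cs))
poly-vanishes s cs B s+len≤B n B≤n =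
  trans (shift-≥ s (poly cs) n (≤-trans (m≤m+n s (length cs)) s+len≤n))
        (beyond cs (n ∸ s) (subst (_≤ n ∸ s) (m+n∸m≡n s (length cs)) (∸-monoˡ-≤ s s+len≤n)))
  where
  s+len≤n = ≤-trans s+len≤B B≤n
  beyond : ∀ cs n → length cs ≤ n → poly cs n ≡ + 0
  beyond []       n       _         = refl
  beyond (c ∷ cs) (suc n) (s≤s len≤n) = beyond cs n len≤n

-- Both sides vanish from degree B on; below B they are compared by evaluating the tables.
Dgf-identity : ∀ r k B (p : Series) {_ : T (r ≤ᵇ 4)} →
               EventuallyZero B (mul1-x²^ k (tableSeries r)) → EventuallyZero B p →
               all (λ n → does (mul1-x²^ k (tableSeries r) n ℤ.≟ p n)) (upTo B) ≡ true →
               ∀ n → mul1-x²^ k (Dgf r) n ≡ p n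
Dgf-identity r k B p {r≤4} lhs≡0 p≡0 agree n =
  trans (mul1-x²^-cong (λ i → cong +_ (D≡table r (≤ᵇ⇒≤ r 4 r≤4) i)) k n) (series-agree n)
  where
  series-agree : ∀ n → mul1-x²^ k (tableSeries r) n ≡ p n
  series-agree n with n <? B
  ... | yes n<B = all-agree⇒≡ ℤ._≟_ (mul1-x²^ k (tableSeries r)) p B agree n n<B
  ... | no  n≮B = trans (lhs≡0 n (≮⇒≥ n≮B)) (sym (p≡0 n (≮⇒≥ n≮B)))

theorem3p6 : ((n : ℕ) → mul1-x²^ 1 (Dgf 0) n
    ≡ poly (+ 1 ∷ + 1 ∷ + 0 ∷ + 0 ∷ + 1 ∷ - + 1 ∷ []) n)
    × ((n : ℕ) → mul1-x²^ 2 (Dgf 1) n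
    ≡ shift 5 (poly (+ 2 ∷ + 3 ∷ - + 4 ∷ - + 1 ∷ + 2 ∷ [])) n)
    × ((n : ℕ) → mul1-x²^ 3 (Dgf 2) n
    ≡ shift 7 (poly (+ 2 ∷ + 2 ∷ - + 6 ∷ - + 1 ∷ + 6 ∷ + 1 ∷ - + 2 ∷ [])) n)
    × ((n : ℕ) → mul1-x²^ 4 (Dgf 3) n
    ≡ shift 7 (poly (+ 3 ∷ + 5 ∷ - + 10 ∷ - + 9 ∷ + 10 ∷ + 3 ∷ + 0 ∷ + 4 ∷ - + 5 ∷ - + 1 ∷ + 2 ∷ [])) n)
    × ((n : ℕ) → mul1-x²^ 5 (Dgf 4) n
    ≡ shift 9 (poly (+ 5 ∷ + 5 ∷ - + 23 ∷ - + 7 ∷ + 40 ∷ - + 1 ∷ - + 30 ∷ + 5 ∷ + 5 ∷ - + 1 ∷ + 5 ∷ + 1 ∷ - + 2 ∷ [])) n)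
theorem3p6 =
  Dgf-identity 0 1 14 _ tableSeries-tail₀ (poly-vanishes 0 _ 14 (≤ᵇ⇒≤ 6 14 tt)) refl ,
  Dgf-identity 1 2 18 _ tableSeries-tail₁ (poly-vanishes 5 _ 18 (≤ᵇ⇒≤ 10 18 tt)) refl ,
  Dgf-identity 2 3 22 _ tableSeries-tail₂ (poly-vanishes 7 _ 22 (≤ᵇ⇒≤ 14 22 tt)) refl ,
  Dgf-identity 3 4 26 _ tableSeries-tail₃ (poly-vanishes 7 _ 26 (≤ᵇ⇒≤ 18 26 tt)) refl ,
  Dgf-identity 4 5 30 _ tableSeries-tail₄ (poly-vanishes 9 _ 30 (≤ᵇ⇒≤ 22 30 tt)) refl
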